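{- Let $\mathbf{x}$ be a linearly recurrent infinite word and let $\boldsymbol{\tau}=(\tau_n\colon \mathcal{A}_{n+1}^*\to\mathcal{A}_n^*,\ a_n\in\mathcal{A}_n)_{n\ge 0}$ be a congenial sequence generating $\mathbf{x}$ that satisfies the following three conditions: (P) there exists $k\in\mathbb{N}$ such that $\tau_{n,n+k}$ is positive for all $n\ge 0$; (F) the set $\{\tau_n : n\ge 0\}$ is finite; (D) for every $n\ge 0$, the substitution $\tau_n$ is decisive in $\mathbf{x}^{(n+1)}$. For $n\ge 0$ let $\mathbf{x}^{(n)}$ denote the limit of $(\tau_{n,m}(a_m))_{m>n}$. Suppose that there is a sequence $(B_n)_{n\ge 0}$ of positive reals such that $\mathbf{x}^{(n)}$ is $B_n$-letter-balanced for every $n\ge 0$. Then $\mathbf{x}$ is factor-balanced. Moreover, if the sequence $(B_n)_{n\ge 0}$ is bounded, then $\mathbf{x}$ is uniformly factor-balanced.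
   Context: Words: for finite words $u,w$, $|u|_w$ denotes the number of (possibly overlapping) occurrences of $w$ in $u$; $\mathcal{L}(\mathbf{x})$ is the set of finite factors of an infinite word $\mathbf{x}$. For $C>0$, a finite word $w$ is $C$-balanced in $\mathbf{x}$ if $\big||u|_w-|v|_w\big|\le C$ for all $u,v\in\mathcal{L}(\mathbf{x})$ with $|u|=|v|$. $\mathbf{x}$ is $C$-letter-balanced if every letter is $C$-balanced in $\mathbf{x}$; factor-balanced if each finite word $w$ is $C_w$-balanced in $\mathbf{x}$ for some constant $C_w>0$; uniformly factor-balanced if there is one $C>0$ such that every finite word is $C$-balanced in $\mathbf{x}$. Linear recurrence: for nonempty $u\in\mathcal{L}(\mathbf{x})$, a return word to $u$ is a word $w$ with $wu\in\mathcal{L}(\mathbf{x})$ such that $u$ occurs exactly twice in $wu$ (as a prefix and as a suffix). $\mathbf{x}$ is linearly recurrent (with constant $L$) if every factor occurs infinitely often, return word sets are nonempty, and $|w|\le L|u|$ for every nonempty $u\in\mathcal{L}(\mathbf{x})$ and every return word $w$ to $u$. Congenial sequences: $(\mathcal{A}_n)_{n\ge0}$ are finite alphabets, $\tau_n\colon\mathcal{A}_{n+1}^*\to\mathcal{A}_n^*$ are substitutions (monoid morphisms), $a_n\in\mathcal{A}_n$, and $\tau_n(a_{n+1})$ begins with $a_n$ for all $n$. For $n>m\ge0$, $\tau_{m,n}=\tau_m\circ\tau_{m+1}\circ\cdots\circ\tau_{n-1}$. Then $\tau_{m,n}(a_n)$ is a prefix of $\tau_{m,n+1}(a_{n+1})$,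 so $\mathbf{x}^{(m)}=\lim_{n\to\infty}\tau_{m,n}(a_n)$ exists (in $\mathcal{A}_m^{\mathbb{N}}\cup\mathcal{A}_m^*$); the sequence generates $\mathbf{x}=\mathbf{x}^{(0)}$. $\tau_{m,n}$ is positive if every $b\in\mathcal{A}_m$ occurs in $\tau_{m,n}(a)$ for every $a\in\mathcal{A}_n$. Decisiveness: for $\mathbf{y}\in\mathcal{A}^{\mathbb{N}}$ and $k\in\mathbb{N}$, a substitution $\tau\colon\mathcal{A}^*\to\mathcal{B}^*$ is $k$-decisive in $\mathbf{y}$ if there is a map $r\colon\mathcal{A}\to\mathcal{B}^k$ such that $\tau(b)$ begins with $r(a)$ for all letters $a,b$ with $ab\in\mathcal{L}(\mathbf{y})$; "decisive" means $k$-decisive for some $k\ge1$. -}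

module Defs where

open import Data.Nat using (ℕ; zero; suc; _+_; _*_; _≤_; _<_; ∣_-_∣)
open import Data.Bool using (Bool; true; false; if_then_else_)
open import Data.Fin using (Fin; _≟_; cast)
open import Data.List using (List; []; _∷_; _++_; length; map; upTo; concatMap)
open import Data.List.Membership.Propositional using (_∈_)
open import Data.Vec using (Vec; toList)
open import Data.Product using (Σ; ∃; ∃-syntax; _×_; _,_)
open import Relation.Nullary using (¬_; does)
open import Relation.Binary.PropositionalEquality using (_≡_)

Word : ℕ → Set
Word n = List (Fin n)

InfWord : ℕ → Set
InfWord n = ℕ → Fin n

factor : ∀ {n} → InfWord n → ℕ → ℕ → Word n
factor x i len = map (λ j → x (i + j)) (upTo len)

isPrefix : ∀ {n} → Word n → Word n → Bool
isPrefix [] _ = true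
isPrefix (_ ∷ _) [] = false
isPrefix (a ∷ w) (b ∷ u) = if does (a ≟ b) then isPrefix w u else false

-- |u|_w : number of (possibly overlapping) occurrences of w in u
-- (= number of suffixes of u having w as a prefix)
occ : ∀ {n} → Word n → Word n → ℕ
occ w [] = if isPrefix w [] then 1 else 0
occ w (b ∷ u) = (if isPrefix w (b ∷ u) then 1 else 0) + occ w u

InL : ∀ {n} → InfWord n → Word n → Set
InL x u = ∃[ i ] factor x i (length u) ≡ u

-- Balancedness (constants are natural numbers)

Balanced : ∀ {n} → ℕ → Word n → InfWord n → Set
Balanced C w x = ∀ (u v : Word _) → InL x u → InL x v → length u ≡ length v →
                 ∣ occ w u - occ w v ∣ ≤ C

LetterBalanced : ∀ {n} → ℕ → InfWord n → Set
LetterBalanced C x = ∀ c → Balanced C (c ∷ []) x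

FactorBalanced : ∀ {n} → InfWord n → Set
FactorBalanced {n} x = ∀ (w : Word n) → ∃[ C ] (0 < C × Balanced C w x)

UniformlyFactorBalanced : ∀ {n} → InfWord n → Set
UniformlyFactorBalanced {n} x = ∃[ C ] (0 < C × (∀ (w : Word n) → Balanced C w x))

NonEmpty : ∀ {n} → Word n → Set
NonEmpty u = ¬ (u ≡ [])

ReturnWord : ∀ {n} → InfWord n → Word n → Word n → Set
ReturnWord x u w = InL x (w ++ u) × isPrefix u (w ++ u) ≡ true × occ u (w ++ u) ≡ 2

LinearlyRecurrentWith : ∀ {n} → ℕ → InfWord n → Set
LinearlyRecurrentWith {n} L x =
  (∀ (u : Word n) → InL x u → ∀ N → ∃[ i ] (N ≤ i × factor x i (length u) ≡ u)) ×
  (∀ (u : Word n) → NonEmpty u → InL x u → ∃[ w ] ReturnWord x u w) ×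
  (∀ (u w : Word n) → NonEmpty u → InL x u → ReturnWord x u w → length w ≤ L * length u)

LinearlyRecurrent : ∀ {n} → InfWord n → Set
LinearlyRecurrent x = ∃[ L ] LinearlyRecurrentWith L x

-- Sequences of substitutions.  Alphabet 𝒜ₙ = Fin (s n);
-- τ n : 𝒜_{n+1} → 𝒜_n^* (extended to a monoid morphism by concatMap).

Subst : (ℕ → ℕ) → Set
Subst s = (n : ℕ) → Fin (s (suc n)) → Word (s n)

-- τ_{m,d+m} = τ_m ∘ ⋯ ∘ τ_{d+m-1}  (τ_{m,m} = identity), on letters
comp : ∀ {s} → Subst s → (m d : ℕ) → Fin (s (d + m)) → Word (s m)
comp τ m zero a = a ∷ []
comp τ m (suc d) a = concatMap (comp τ m d) (τ (d + m) a)

Congenial : ∀ {s} → Subst s → ((n : ℕ) → Fin (s n)) → Set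
Congenial τ a = ∀ n → ∃[ rest ] τ n (a (suc n)) ≡ a n ∷ rest

IsLimit : ∀ {s} → Subst s → ((n : ℕ) → Fin (s n)) → (m : ℕ) → InfWord (s m) → Set
IsLimit τ a m y = ∀ i → ∃[ d ] ∃[ rest ] comp τ m d (a (d + m)) ≡ factor y 0 i ++ rest

Positive : ∀ {s} → Subst s → (m d : ℕ) → Set
Positive {s} τ m d = ∀ (b : Fin (s m)) (c : Fin (s (d + m))) → b ∈ comp τ m d c

CondP : ∀ {s} → Subst s → Set
CondP τ = ∃[ k ] (∀ n → Positive τ n k)

SameSubst : ∀ {s} → Subst s → ℕ → ℕ → Set
SameSubst {s} τ m n =
  Σ (s m ≡ s n) λ e₀ → Σ (s (suc m) ≡ s (suc n)) λ e₁ →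
    ∀ b → map (cast e₀) (τ m b) ≡ τ n (cast e₁ b)

-- (F): {τₙ : n ≥ 0} is finite, i.e. every τₙ equals one of τ₀,…,τ_{N-1}
CondF : ∀ {s} → Subst s → Set
CondF τ = ∃[ N ] (∀ n → ∃[ m ] (m < N × SameSubst τ m n))

Decisive-k : ∀ {p q} → (Fin p → Word q) → ℕ → InfWord p → Set
Decisive-k {p} {q} σ k y = Σ (Fin p → Vec (Fin q) k) λ r →
  ∀ a b → InL y (a ∷ b ∷ []) → ∃[ rest ] σ b ≡ toList (r a) ++ rest

Decisive : ∀ {p q} → (Fin p → Word q) → InfWord p → Set
Decisive σ y = ∃[ k ] (1 ≤ k × Decisive-k σ k y)

CondD : ∀ {s} → Subst s → ((n : ℕ) → InfWord (s n)) → Set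
CondD τ xs = ∀ n → Decisive (τ n) (xs (suc n))

BoundedSeq : (ℕ → ℕ) → Set
BoundedSeq B = ∃[ M ] (∀ n → B n ≤ M)

-- Fix a nonempty factor w.  If w has a period p that is small compared with |w|, linear
-- recurrence forces x itself to be p-periodic, and then counts of w in equally long windows differ
-- by at most one.  Otherwise distinct occurrences of w are at least |w|/Λ apart, where Λ = 2(L+1)
-- for the recurrence constant L.  Climbing the levels k at a time, block lengths |τ₀,ₙ(b)| at least
-- double while the alphabet has two letters, and by (P) and (F) the blocks of one level have
-- comparable lengths; so either x is periodic with a period shorter than w, or some level n + 1 has
-- all blocks of length between |w| and a constant multiple of |w|.  By decisiveness of τₙ, each such
-- block is followed by a word of length at least |w| determined by its letter, so the number of
-- occurrences of w starting inside a block depends only on that letter.  A window of x is then a run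
-- of whole blocks plus two partial ones, the occurrences in the run are a weighted letter count of a
-- factor of x⁽ⁿ⁺¹⁾, and letter-balance of x⁽ⁿ⁺¹⁾ bounds their difference by a constant depending
-- only on B_{n+1}.

module Submission where

open import Defs
open import Data.Bool using (Bool; true; false; if_then_else_)
import Data.Bool as Bool
open import Data.Empty using (⊥-elim)
open import Data.Fin using (Fin; zero; suc; _≟_; cast)
open import Data.Fin.Properties using (cast-involutive; all?; ¬∀⟶∃¬)
open import Data.List using (List; []; _∷_; _++_; length; map; concatMap; applyUpTo; drop)
open import Data.List.Effectful using (module MonadProperties)
open import Data.List.Membership.Propositional using (_∈_)
open import Data.List.Properties
  using ( length-++; length-map; ++-assoc; ++-identityʳ; ∷-injective; ∷-injectiveˡ; ∷-injectiveʳ; ≡-dec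
        ; map-id; map-++; concatMap-++; concatMap-cong; concatMap-map)
open import Data.List.Relation.Unary.Any using (here; there)
open import Data.Nat
  using ( ℕ; zero; suc; _+_; _*_; _^_; _∸_; _≤_; _<_; z≤n; s≤s; ∣_-_∣; _⊓_; _⊔_; _/_; _%_; _≤?_
        ; NonZero; >-nonZero)
  renaming (_≟_ to _≟ℕ_)
open import Data.Nat.DivMod using (m≡m%n+[m/n]*n; m%n<n)
open import Data.Nat.Induction using (<-rec)
open import Data.Nat.ListAction using (sum)
open import Data.Nat.ListAction.Properties using (sum-++)
open import Data.Nat.Properties hiding (_≟_)
open import Data.Nat.Tactic.RingSolver using (solve-∀)
open import Algebra.Properties.CommutativeSemigroup +-commutativeSemigroup using () renaming (xy∙z≈xz∙y to +-right-comm)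
open import Algebra.Properties.Semiring.Sum +-*-semiring
  using (sum-syntax; sum-cong-≗; sum-replicate-zero; ∑-distrib-+) renaming (sum to ∑)
open import Data.Product using (Σ; ∃-syntax; _×_; _,_; proj₁; proj₂)
open import Data.Sum using (_⊎_; inj₁; inj₂; [_,_]′)
open import Data.Vec using (Vec; _∷_; toList; head)
open import Relation.Nullary using (¬_; Dec; yes; no; does; _×-dec_)
open import Relation.Nullary.Decidable using (dec-true)
open import Relation.Unary using (Pred; Decidable)
open import Relation.Binary.PropositionalEquality

∣-∣≤-intro : ∀ m n k → m ≤ n + k → n ≤ m + k → ∣ m - n ∣ ≤ k
∣-∣≤-intro zero    n       k _         n≤k       = n≤k
∣-∣≤-intro (suc m) zero    k m≤k       _         = m≤k
∣-∣≤-intro (suc m) (suc n) k (s≤s m≤) (s≤s n≤) = ∣-∣≤-intro m n k m≤ n≤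

∣-∣≤-elim : ∀ {m n k} → ∣ m - n ∣ ≤ k → m ≤ n + k
∣-∣≤-elim {m} {n} h = ≤-trans (m≤n+∣m-n∣ m n) (+-monoʳ-≤ n h)

++-cancel-length : ∀ {A : Set} (u v : List A) {r r′} → length u ≡ length v → u ++ r ≡ v ++ r′ → u ≡ v × r ≡ r′
++-cancel-length []      []      _ e = refl , e
++-cancel-length (a ∷ u) (b ∷ v) l e with ∷-injective e
... | refl , e′ = let (u≡v , r≡r′) = ++-cancel-length u v (suc-injective l) e′ in cong (a ∷_) u≡v , r≡r′

module _ {p} {P : Pred ℕ p} (P? : Decidable P) where

  search : ∀ W → (∀ t → t < W → ¬ P t) ⊎ ∃[ t ] (t < W × P t × ∀ t′ → t′ < t → ¬ P t′)
  search zero = inj₁ (λ _ ())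
  search (suc W) with search W
  ... | inj₂ (t , t<W , pt , min) = inj₂ (t , m≤n⇒m≤1+n t<W , pt , min)
  ... | inj₁ none with P? W
  ...   | yes pW = inj₂ (W , ≤-refl , pW , none)
  ...   | no ¬pW = inj₁ λ t t<1+W → [ none t , (λ { refl → ¬pW }) ]′ (m<1+n⇒m<n∨m≡n t<1+W)

  least : ∀ {K} → P K → ∃[ t ] (t ≤ K × P t × ∀ t′ → t′ < t → ¬ P t′)
  least {K} pK with search K
  ... | inj₂ (t , t<K , pt , min) = t , <⇒≤ t<K , pt , min
  ... | inj₁ none = K , ≤-refl , pK , none

module _ {p} {P : Pred ℕ p} (P? : Decidable P) where

  straddle : ∀ {a b i} → P a → a ≤ i → P b → i < b →
             ∃[ s ] ∃[ t ] (s ≤ i × i < t × P s × P t × ∀ r → s < r → r < t → ¬ P r)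
  straddle {a} {b} {i} Pa a≤i Pb i<b
    with least (λ j → P? (i ∸ j)) {i ∸ a} (subst P (sym (m∸[m∸n]≡n a≤i)) Pa)
       | least (λ k → P? (suc i + k)) {b ∸ suc i} (subst P (sym (m+[n∸m]≡n i<b)) Pb)
  ... | j , _ , Pi∸j , none-below | k , _ , Pi+1+k , none-above =
    i ∸ j , suc i + k , m∸n≤m i j , s≤s (m≤m+n i k) , Pi∸j , Pi+1+k , between
    where
    between : ∀ r → i ∸ j < r → r < suc i + k → ¬ P r
    between r i∸j<r r<t with r ≤? i
    ... | yes r≤i = subst (λ r → ¬ P r) (m∸[m∸n]≡n r≤i) (none-below (i ∸ r) i∸r<j)
      where
      i∸r<j : i ∸ r < j
      i∸r<j = ≰⇒> λ j≤i∸r → <⇒≱ i∸j<r (subst (_≤ i ∸ j) (m∸[m∸n]≡n r≤i) (∸-monoʳ-≤ i j≤i∸r))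
    ... | no r≰i = subst (λ r → ¬ P r) (m+[n∸m]≡n (≰⇒> r≰i)) (none-above (r ∸ suc i) r∸i<k)
      where
      r∸i<k : r ∸ suc i < k
      r∸i<k = +-cancelˡ-< (suc i) _ _ (subst (_< suc i + k) (sym (m+[n∸m]≡n (≰⇒> r≰i))) r<t)

crossing : (f : ℕ → ℕ) {Q : ℕ} → f 0 ≤ Q → ∀ K → Q < f K → ∃[ j ] (f j ≤ Q × Q < f (suc j))
crossing f f0≤Q zero    Q<f0 = ⊥-elim (<⇒≱ Q<f0 f0≤Q)
crossing f f0≤Q (suc K) Q<fK with f K ≤? _
... | yes fK≤Q = K , fK≤Q , Q<fK
... | no fK≰Q  = crossing f f0≤Q K (≰⇒> fK≰Q)

window : ∀ {n} → InfWord n → ℕ → ℕ → Word n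
window x P zero    = []
window x P (suc N) = x P ∷ window x (suc P) N

module _ {n} (x : InfWord n) where

  length-window : ∀ P N → length (window x P N) ≡ N
  length-window P zero    = refl
  length-window P (suc N) = cong suc (length-window (suc P) N)

  factor≡window : ∀ P N → factor x P N ≡ window x P N
  factor≡window P N = go (λ j → j) P N (λ _ → refl)
    where
    go : ∀ f Q N → (∀ j → P + f j ≡ Q + j) → map (λ j → x (P + j)) (applyUpTo f N) ≡ window x Q N
    go f Q zero    _  = refl
    go f Q (suc N) eq = cong₂ _∷_ (cong x (trans (eq 0) (+-identityʳ Q)))
                                  (go (λ j → f (suc j)) (suc Q) N (λ j → trans (eq (suc j)) (+-suc Q j)))

  InL-window : ∀ P N → InL x (window x P N)
  InL-window P N = P , trans (factor≡window P _) (cong (window x P) (length-window P N))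

  window-+ : ∀ P m k → window x P (m + k) ≡ window x P m ++ window x (P + m) k
  window-+ P zero    k = cong (λ Q → window x Q k) (sym (+-identityʳ P))
  window-+ P (suc m) k = cong (x P ∷_) (trans (window-+ (suc P) m k)
    (cong (λ Q → window x (suc P) m ++ window x Q k) (sym (+-suc P m))))

  drop-window : ∀ p P N → drop p (window x P N) ≡ window x (P + p) (N ∸ p)
  drop-window zero    P N       = cong (λ Q → window x Q N) (sym (+-identityʳ P))
  drop-window (suc p) P zero    = refl
  drop-window (suc p) P (suc N) = trans (drop-window p (suc P) N) (cong (λ Q → window x Q (N ∸ p)) (sym (+-suc P p)))

module _ {n} (x y : InfWord n) where

  window-cong : ∀ P Q N → (∀ t → t < N → x (P + t) ≡ y (Q + t)) → window x P N ≡ window y Q N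
  window-cong P Q zero    _  = refl
  window-cong P Q (suc N) eq = cong₂ _∷_
    (subst₂ (λ i j → x i ≡ y j) (+-identityʳ P) (+-identityʳ Q) (eq 0 (s≤s z≤n)))
    (window-cong (suc P) (suc Q) N λ t t<N → subst₂ (λ i j → x i ≡ y j) (+-suc P t) (+-suc Q t) (eq (suc t) (s≤s t<N)))

  window-lookup : ∀ P Q N → window x P N ≡ window y Q N → ∀ t → t < N → x (P + t) ≡ y (Q + t)
  window-lookup P Q (suc N) eq zero    _         =
    subst₂ (λ i j → x i ≡ y j) (sym (+-identityʳ P)) (sym (+-identityʳ Q)) (∷-injectiveˡ eq)
  window-lookup P Q (suc N) eq (suc t) (s≤s t<N) =
    subst₂ (λ i j → x i ≡ y j) (sym (+-suc P t)) (sym (+-suc Q t)) (window-lookup (suc P) (suc Q) N (∷-injectiveʳ eq) t t<N)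

isPrefix-++ : ∀ {n} (u r : Word n) → isPrefix u (u ++ r) ≡ true
isPrefix-++ []      r = refl
isPrefix-++ (a ∷ u) r rewrite dec-true (a ≟ a) refl = isPrefix-++ u r

isPrefix⇒++ : ∀ {n} (u v : Word n) → isPrefix u v ≡ true → ∃[ r ] v ≡ u ++ r
isPrefix⇒++ []      v       _ = v , refl
isPrefix⇒++ (a ∷ u) (b ∷ v) h with a ≟ b
... | yes refl = let (r , v≡u++r) = isPrefix⇒++ u v h in r , cong (a ∷_) v≡u++r

isPrefix-++ʳ : ∀ {n} (u v r : Word n) → length u ≤ length v → isPrefix u (v ++ r) ≡ isPrefix u v
isPrefix-++ʳ []      v       r _         = refl
isPrefix-++ʳ (a ∷ u) (b ∷ v) r (s≤s u≤v) with does (a ≟ b)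
... | true  = isPrefix-++ʳ u v r u≤v
... | false = refl

isPrefix-short : ∀ {n} (u v : Word n) → length v < length u → isPrefix u v ≡ false
isPrefix-short u v v<u with isPrefix u v in eq
... | false = refl
... | true  = let (r , v≡u++r) = isPrefix⇒++ u v eq in
  ⊥-elim (<⇒≱ v<u (subst (length u ≤_) (sym (trans (cong length v≡u++r) (length-++ u))) (m≤m+n _ _)))

isPrefix-same-length : ∀ {n} (u v : Word n) → isPrefix u v ≡ true → length v ≡ length u → v ≡ u
isPrefix-same-length u v h l with isPrefix⇒++ u v h
... | [] , refl    = ++-identityʳ u
... | _ ∷ _ , refl = ⊥-elim (m+1+n≢m (length u) (trans (sym (length-++ u)) l))

OccursAt : ∀ {n} → InfWord n → ℕ → Word n → Set
OccursAt x P u = window x P (length u) ≡ u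

occursAt? : ∀ {n} (x : InfWord n) P (u : Word n) → Dec (OccursAt x P u)
occursAt? x P u = ≡-dec _≟_ (window x P (length u)) u

OccursAt-window : ∀ {n} (x : InfWord n) P N → OccursAt x P (window x P N)
OccursAt-window x P N = cong (window x P) (length-window x P N)

OccursAt-++ : ∀ {n} (x : InfWord n) P (u v : Word n) → OccursAt x P (u ++ v) → OccursAt x P u × OccursAt x (P + length u) v
OccursAt-++ x P u v occ = ++-cancel-length _ _ (length-window x P (length u)) split
  where
  split : window x P (length u) ++ window x (P + length u) (length v) ≡ u ++ v
  split = trans (sym (window-+ x P (length u) (length v))) (trans (cong (window x P) (sym (length-++ u))) occ)

HasPeriod : ∀ {n} → Word n → ℕ → Set
HasPeriod w p = isPrefix (drop p w) w ≡ true

occurrence-shift : ∀ {n} (x : InfWord n) {w i p} → OccursAt x i w → HasPeriod w p →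
                   ∀ t → t + p < length w → x (i + t + p) ≡ x (i + t)
occurrence-shift x {w} {i} {p} occ period t t+p<L =
  trans (cong x (+-right-comm i t p)) (window-lookup x x (i + p) i (L ∸ p) (sym shifted) t (m+n≤o⇒m≤o∸n (suc t) t+p<L))
  where
  L = length w
  p≤L : p ≤ L
  p≤L = ≤-trans (m≤n+m p (suc t)) t+p<L
  suffix : drop p w ≡ window x (i + p) (L ∸ p)
  suffix = trans (cong (drop p) (sym occ)) (drop-window x p i L)
  rest = isPrefix⇒++ (drop p w) w period
  split : window x i (L ∸ p) ++ window x (i + (L ∸ p)) p ≡ window x (i + p) (L ∸ p) ++ proj₁ rest
  split = trans (sym (window-+ x i (L ∸ p) p)) (trans (cong (window x i) (m∸n+n≡m p≤L))
            (trans occ (trans (proj₂ rest) (cong (_++ proj₁ rest) suffix))))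
  shifted : window x i (L ∸ p) ≡ window x (i + p) (L ∸ p)
  shifted = proj₁ (++-cancel-length _ _ (trans (length-window x i (L ∸ p)) (sym (length-window x (i + p) (L ∸ p)))) split)

overlapping⇒HasPeriod : ∀ {n} (x : InfWord n) {w i d} → OccursAt x i w → OccursAt x (i + d) w → HasPeriod w d
overlapping⇒HasPeriod x {w} {i} {d} occ occ-d = subst₂ (λ u v → isPrefix u v ≡ true) (sym suffix) occ-d
  (subst (λ v → isPrefix (window x (i + d) (L ∸ d)) v ≡ true) (sym split) (isPrefix-++ (window x (i + d) (L ∸ d)) _))
  where
  L = length w
  suffix : drop d w ≡ window x (i + d) (L ∸ d)
  suffix = trans (cong (drop d) (sym occ)) (drop-window x d i L)
  split : window x (i + d) L ≡ window x (i + d) (L ∸ d) ++ window x (i + d + (L ∸ d)) (L ∸ (L ∸ d))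
  split = trans (cong (window x (i + d)) (sym (m+[n∸m]≡n (m∸n≤m L d)))) (window-+ x (i + d) (L ∸ d) _)

indicator : Bool → ℕ
indicator b = if b then 1 else 0

hit : ∀ {n} → InfWord n → Word n → ℕ → ℕ
hit x w i = indicator (does (occursAt? x i w))

count : ∀ {n} → InfWord n → Word n → ℕ → ℕ → ℕ
count x w P zero    = 0
count x w P (suc W) = hit x w P + count x w (suc P) W

CountBalanced : ∀ {n} → ℕ → InfWord n → Word n → Set
CountBalanced C x w = ∀ P Q W → ∣ count x w P W - count x w Q W ∣ ≤ C

CountBalanced-mono : ∀ {n} {x : InfWord n} {w C C′} → C ≤ C′ → CountBalanced C x w → CountBalanced C′ x w
CountBalanced-mono C≤C′ bal P Q W = ≤-trans (bal P Q W) C≤C′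

nonempty⇒length≥1 : ∀ {A : Set} (u : List A) → ¬ u ≡ [] → 1 ≤ length u
nonempty⇒length≥1 []      u≢[] = ⊥-elim (u≢[] refl)
nonempty⇒length≥1 (_ ∷ _) _    = s≤s z≤n

module _ {n} (x : InfWord n) (w : Word n) where

  hit-yes : ∀ {i} → OccursAt x i w → hit x w i ≡ 1
  hit-yes {i} occ with occursAt? x i w
  ... | yes _  = refl
  ... | no ¬occ = ⊥-elim (¬occ occ)

  hit-no : ∀ {i} → ¬ OccursAt x i w → hit x w i ≡ 0
  hit-no {i} ¬occ with occursAt? x i w
  ... | yes occ = ⊥-elim (¬occ occ)
  ... | no _    = refl

  hit-cong : ∀ {i j} → window x i (length w) ≡ window x j (length w) → hit x w i ≡ hit x w j
  hit-cong eq = cong (λ v → indicator (does (≡-dec _≟_ v w))) eq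

  isPrefix-window : ∀ i N → length w ≤ N → isPrefix w (window x i N) ≡ does (occursAt? x i w)
  isPrefix-window i N w≤N = begin
    isPrefix w (window x i N)
      ≡⟨ cong (isPrefix w) (trans (cong (window x i) (sym (m+[n∸m]≡n w≤N))) (window-+ x i (length w) (N ∸ length w))) ⟩
    isPrefix w (window x i (length w) ++ window x (i + length w) (N ∸ length w))
      ≡⟨ isPrefix-++ʳ w _ _ (≤-reflexive (sym (length-window x i (length w)))) ⟩
    isPrefix w (window x i (length w))
      ≡⟨ reflect (occursAt? x i w) ⟩
    does (occursAt? x i w) ∎
    where
    open ≡-Reasoning
    reflect : (d : Dec (OccursAt x i w)) → isPrefix w (window x i (length w)) ≡ does d
    reflect (yes occ) = subst (λ v → isPrefix w v ≡ true) (sym (trans occ (sym (++-identityʳ w)))) (isPrefix-++ w [])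
    reflect (no ¬occ) with isPrefix w (window x i (length w)) in eq
    ... | false = refl
    ... | true  = ⊥-elim (¬occ (isPrefix-same-length w _ eq (length-window x i (length w))))

  count-+ : ∀ P a b → count x w P (a + b) ≡ count x w P a + count x w (P + a) b
  count-+ P zero    b = cong (λ Q → count x w Q b) (sym (+-identityʳ P))
  count-+ P (suc a) b = trans (cong (hit x w P +_) (trans (count-+ (suc P) a b)
                                (cong (λ Q → count x w (suc P) a + count x w Q b) (sym (+-suc P a)))))
                              (sym (+-assoc (hit x w P) _ _))

  count-mono : ∀ P {a b} → a ≤ b → count x w P a ≤ count x w P b
  count-mono P {a} {b} a≤b = subst (λ c → count x w P a ≤ count x w P c) (m+[n∸m]≡n a≤b)
    (subst (count x w P a ≤_) (sym (count-+ P a (b ∸ a))) (m≤m+n _ _))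

  count-absent : ∀ P W → (∀ t → t < W → ¬ OccursAt x (P + t) w) → count x w P W ≡ 0
  count-absent P zero    _    = refl
  count-absent P (suc W) none = cong₂ _+_
    (hit-no (subst (λ Q → ¬ OccursAt x Q w) (+-identityʳ P) (none 0 (s≤s z≤n))))
    (count-absent (suc P) W λ t t<W → subst (λ Q → ¬ OccursAt x Q w) (+-suc P t) (none (suc t) (s≤s t<W)))

  occ-window : ¬ w ≡ [] → ∀ P N → occ w (window x P N) ≡ count x w P (suc N ∸ length w)
  occ-window w≢[] P zero = begin
    indicator (isPrefix w [])
      ≡⟨ cong indicator (isPrefix-short w [] (nonempty⇒length≥1 w w≢[])) ⟩
    0
      ≡⟨ cong (count x w P) (m≤n⇒m∸n≡0 (nonempty⇒length≥1 w w≢[])) ⟨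
    count x w P (1 ∸ length w) ∎
    where open ≡-Reasoning
  occ-window w≢[] P (suc N) with length w ≤? suc N
  ... | yes w≤ = begin
    indicator (isPrefix w (window x P (suc N))) + occ w (window x (suc P) N)
      ≡⟨ cong₂ _+_ (cong indicator (isPrefix-window P (suc N) w≤)) (occ-window w≢[] (suc P) N) ⟩
    count x w P (suc (suc N ∸ length w))
      ≡⟨ cong (count x w P) (sym (+-∸-assoc 1 w≤)) ⟩
    count x w P (suc (suc N) ∸ length w) ∎
    where open ≡-Reasoning
  ... | no w≰ = begin
    indicator (isPrefix w (window x P (suc N))) + occ w (window x (suc P) N)
      ≡⟨ cong₂ _+_ (cong indicator (isPrefix-short w _ short)) (occ-window w≢[] (suc P) N) ⟩
    count x w (suc P) (suc N ∸ length w)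
      ≡⟨ cong (count x w (suc P)) (m≤n⇒m∸n≡0 (<⇒≤ (≰⇒> w≰))) ⟩
    0
      ≡⟨ cong (count x w P) (m≤n⇒m∸n≡0 (≰⇒> w≰)) ⟨
    count x w P (suc (suc N) ∸ length w) ∎
    where
    open ≡-Reasoning
    short : length (window x P (suc N)) < length w
    short = subst (_< length w) (sym (length-window x P (suc N))) (≰⇒> w≰)

occ-[] : ∀ {n} (u : Word n) → occ [] u ≡ suc (length u)
occ-[] []      = refl
occ-[] (_ ∷ u) = cong suc (occ-[] u)

CountBalanced⇒Balanced : ∀ {n} {x : InfWord n} {C} w → CountBalanced C x w → Balanced C w x
CountBalanced⇒Balanced {C = C} [] _ u v _ _ |u|≡|v| =
  subst (_≤ C) (sym (trans (cong₂ ∣_-_∣ (occ-[] u) (trans (occ-[] v) (cong suc (sym |u|≡|v|))))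
                           (∣n-n∣≡0 (suc (length u))))) z≤n
CountBalanced⇒Balanced {x = x} {C} w@(_ ∷ _) bal u v (i , u≡) (j , v≡) |u|≡|v| =
  subst₂ (λ a b → ∣ a - b ∣ ≤ C)
    (sym (occ-factor i u u≡))
    (sym (trans (occ-factor j v v≡) (cong (λ N → count x w j (suc N ∸ length w)) (sym |u|≡|v|))))
    (bal i j (suc (length u) ∸ length w))
  where
  occ-factor : ∀ i u → factor x i (length u) ≡ u → occ w u ≡ count x w i (suc (length u) ∸ length w)
  occ-factor i u u≡ = trans (cong (occ w) (trans (sym u≡) (factor≡window x i _))) (occ-window x w (λ ()) i _)

count-[] : ∀ {n} (x : InfWord n) P W → count x [] P W ≡ W
count-[] x P zero    = refl
count-[] x P (suc W) = cong₂ _+_ (hit-yes x [] {P} refl) (count-[] x (suc P) W)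

CountBalanced-[] : ∀ {n} (x : InfWord n) C → CountBalanced C x []
CountBalanced-[] x C P Q W = subst (_≤ C) (sym (trans (cong₂ ∣_-_∣ (count-[] x P W) (count-[] x Q W)) (∣n-n∣≡0 W))) z≤n

occurrencesIn : ∀ {n} → Word n → Word n → ℕ → ℕ
occurrencesIn w u       zero    = 0
occurrencesIn w []      (suc m) = 0
occurrencesIn w (a ∷ u) (suc m) = indicator (isPrefix w (a ∷ u)) + occurrencesIn w u m

count-occurring : ∀ {n} (x : InfWord n) (w : Word n) {u P} m → OccursAt x P u → m + length w ≤ length u →
                  count x w P m ≡ occurrencesIn w u m
count-occurring x w {u}     {P} zero    _   _ = refl
count-occurring x w {a ∷ u} {P} (suc m) occ (s≤s m+w≤u) = cong₂ _+_
  (cong indicator (sym (trans (cong (isPrefix w) (sym occ))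
    (isPrefix-window x w P (suc (length u)) (≤-trans (m≤n+m (length w) m) (≤-trans m+w≤u (n≤1+n _)))))))
  (count-occurring x w m (∷-injectiveʳ occ) m+w≤u)

CountBalanced-if-occurring : ∀ {n} (x : InfWord n) (w : Word n) {C} →
                             (∀ {i} → OccursAt x i w → CountBalanced C x w) → CountBalanced C x w
CountBalanced-if-occurring x w {C} bal P Q W with search (λ t → occursAt? x (P + t) w) W | search (λ t → occursAt? x (Q + t) w) W
... | inj₂ (_ , _ , occ , _) | _                       = bal occ P Q W
... | inj₁ _                 | inj₂ (_ , _ , occ , _) = bal occ P Q W
... | inj₁ noneP             | inj₁ noneQ             =
  subst (_≤ C) (sym (cong₂ ∣_-_∣ (count-absent x w P W noneP) (count-absent x w Q W noneQ))) z≤n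

-- Periodic words

Periodic : ∀ {n} → InfWord n → ℕ → Set
Periodic x p = ∀ q → x (q + p) ≡ x q

module _ {n} {x : InfWord n} where

  periodic-* : ∀ {p} → Periodic x p → ∀ m q → x (q + m * p) ≡ x q
  periodic-*     per zero    q = cong x (+-identityʳ q)
  periodic-* {p} per (suc m) q = trans (cong x (sym (+-assoc q p (m * p)))) (trans (periodic-* per m (q + p)) (per q))

  periodic-residue : ∀ {p} .{{_ : NonZero p}} → Periodic x p → ∀ i q → ∃[ t ] (t < p × ∀ e → x (q + e) ≡ x (i + t + e))
  periodic-residue {p} per i q = t , m%n<n r p , λ e → begin
    x (q + e)                 ≡⟨ periodic-* per i (q + e) ⟨
    x (q + e + i * p)         ≡⟨ cong x (lift e) ⟩
    x ((i + t + e) + k * p)   ≡⟨ periodic-* per k (i + t + e) ⟩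
    x (i + t + e)             ∎
    where
    open ≡-Reasoning
    i≤ : i ≤ q + i * p
    i≤ = ≤-trans (m≤m*n i p) (m≤n+m (i * p) q)
    r = q + i * p ∸ i
    t = r % p
    k = r / p
    split : q + i * p ≡ i + t + k * p
    split = trans (sym (m+[n∸m]≡n i≤)) (trans (cong (i +_) (m≡m%n+[m/n]*n r p)) (sym (+-assoc i t (k * p))))
    lift : ∀ e → q + e + i * p ≡ (i + t + e) + k * p
    lift e = trans (+-right-comm q e (i * p)) (trans (cong (_+ e) split) (+-right-comm (i + t) (k * p) e))

  shift-periodic : ∀ {p d} .{{_ : NonZero p}} i L → p ≤ L → Periodic x p →
                   (∀ t → t < L → x (i + t + d) ≡ x (i + t)) → Periodic x d
  shift-periodic {p} {d} i L p≤L per agree q =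
    let (t , t<p , same) = periodic-residue per i q in
    trans (same d) (trans (agree t (<-≤-trans t<p p≤L))
      (sym (trans (cong x (sym (+-identityʳ q))) (trans (same 0) (cong x (+-identityʳ (i + t)))))))

  window-periodic : ∀ {d} → Periodic x d → ∀ q N → window x (q + d) N ≡ window x q N
  window-periodic {d} per q N = window-cong x x (q + d) q N λ t _ → trans (cong x (+-right-comm q d t)) (per (q + t))

module _ {n} (x : InfWord n) (w : Word n) where

  count-periodic : ∀ {d} → Periodic x d → ∀ P → count x w P d ≡ count x w 0 d
  count-periodic         per zero    = refl
  count-periodic {d = d} per (suc P) = trans (+-cancelˡ-≡ (hit x w P) _ _ shift) (count-periodic per P)
    where
    shift : hit x w P + count x w (suc P) d ≡ hit x w P + count x w P d
    shift = begin
      count x w P (suc d)                   ≡⟨ cong (count x w P) (+-comm 1 d) ⟩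
      count x w P (d + 1)                   ≡⟨ count-+ x w P d 1 ⟩
      count x w P d + (hit x w (P + d) + 0) ≡⟨ cong (λ h → count x w P d + h) (+-identityʳ _) ⟩
      count x w P d + hit x w (P + d)       ≡⟨ cong (count x w P d +_) (hit-cong x w (window-periodic per P (length w))) ⟩
      count x w P d + hit x w P             ≡⟨ +-comm (count x w P d) _ ⟩
      hit x w P + count x w P d             ∎
      where open ≡-Reasoning

  once-per-period-CountBalanced : ∀ {d} .{{_ : NonZero d}} → (∀ P → count x w P d ≡ 1) → CountBalanced 1 x w
  once-per-period-CountBalanced {d} once P Q W =
    ∣-∣≤-intro _ _ 1 (bounded P Q) (bounded Q P)
    where
    k = W / d
    count-blocks : ∀ m P → count x w P (m * d) ≡ m
    count-blocks zero    P = refl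
    count-blocks (suc m) P = trans (count-+ x w P d (m * d)) (cong₂ _+_ (once P) (count-blocks m (P + d)))
    decompose : ∀ P → count x w P W ≡ k + count x w (P + k * d) (W % d)
    decompose P = trans (cong (count x w P) (trans (m≡m%n+[m/n]*n W d) (+-comm (W % d) (k * d))))
                        (trans (count-+ x w P (k * d) (W % d)) (cong (_+ count x w (P + k * d) (W % d)) (count-blocks k P)))
    remainder≤1 : ∀ P → count x w (P + k * d) (W % d) ≤ 1
    remainder≤1 P = subst (count x w (P + k * d) (W % d) ≤_) (once (P + k * d)) (count-mono x w (P + k * d) (<⇒≤ (m%n<n W d)))
    bounded : ∀ P Q → count x w P W ≤ count x w Q W + 1
    bounded P Q = begin
      count x w P W                          ≡⟨ decompose P ⟩
      k + count x w (P + k * d) (W % d)      ≤⟨ +-monoʳ-≤ k (remainder≤1 P) ⟩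
      k + 1                                  ≤⟨ +-monoˡ-≤ 1 (m≤m+n k _) ⟩
      k + count x w (Q + k * d) (W % d) + 1  ≡⟨ cong (_+ 1) (decompose Q) ⟨
      count x w Q W + 1                      ∎
      where open ≤-Reasoning

  -- The first return d of w after an occurrence is a period of x (by shift-periodic, since |w| ≥ p),
  -- so every window of length d contains exactly one occurrence.
  periodic-CountBalanced : ∀ {p} → suc p ≤ length w → Periodic x (suc p) → CountBalanced 1 x w
  periodic-CountBalanced {p} p<|w| per with search (λ i → occursAt? x i w) (suc p)
  ... | inj₁ none = λ P Q W → subst (_≤ 1) (sym (cong₂ ∣_-_∣ (absent P W) (absent Q W))) z≤n
    where
    absent : ∀ P W → count x w P W ≡ 0
    absent P W = count-absent x w P W λ t _ occ →
      let (r , r<p , same) = periodic-residue per 0 (P + t) in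
      none r r<p (trans (window-cong x x r (P + t) (length w) λ e _ → sym (same e)) occ)
  ... | inj₂ (i , _ , occ-i , _)
    with least (λ d → occursAt? x (i + suc d) w) {p} (trans (window-periodic per i (length w)) occ-i)
  ... | d , _ , occ-d , none-before = once-per-period-CountBalanced {d = suc d} once
    where
    per-d : Periodic x (suc d)
    per-d = shift-periodic i (length w) p<|w| per λ t t<|w| →
      trans (cong x (+-right-comm i t (suc d))) (window-lookup x x (i + suc d) i (length w) (trans occ-d (sym occ-i)) t t<|w|)
    once-at-i : count x w i (suc d) ≡ 1
    once-at-i = cong₂ _+_ (hit-yes x w occ-i) (count-absent x w (suc i) d λ t t<d →
      subst (λ Q → ¬ OccursAt x Q w) (+-suc i t) (none-before t t<d))
    once : ∀ P → count x w P (suc d) ≡ 1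
    once P = trans (count-periodic per-d P) (trans (sym (count-periodic per-d i)) once-at-i)

module _ {n} {x : InfWord n} where

  tiled-Periodic : ∀ {u : Word n} .{{_ : NonZero (length u)}} → (∀ i → OccursAt x (i * length u) u) → Periodic x (length u)
  tiled-Periodic {u} tiles q = begin
    x (q + p)             ≡⟨ cong x (lift p) ⟩
    x (suc t * p + r)     ≡⟨ window-lookup x x (t * p) (suc t * p) p (trans (tiles t) (sym (tiles (suc t)))) r (m%n<n q p) ⟨
    x (t * p + r)         ≡⟨ cong x (lift 0) ⟨
    x (q + 0)             ≡⟨ cong x (+-identityʳ q) ⟩
    x q                   ∎
    where
    open ≡-Reasoning
    p = length u
    t = q / p
    r = q % p
    lift : ∀ e → q + e ≡ e + t * p + r
    lift e = trans (cong (_+ e) (m≡m%n+[m/n]*n q p)) (rearrange r (t * p) e)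
      where
      rearrange : ∀ a b c → a + b + c ≡ c + b + a
      rearrange = solve-∀

-- Sparse occurrences and linear recurrence

Sparse : ∀ {n} → ℕ → InfWord n → Word n → Set
Sparse Λ x w = ∀ i d → OccursAt x i w → OccursAt x (i + suc d) w → length w ≤ Λ * suc d

module _ {n} {x : InfWord n} {w : Word n} {Λ} (sparse : Sparse Λ x w) where

  private
    L = length w

  sparse-count : ∀ W P → L * count x w P W ≤ Λ * W + L
  sparse-count = <-rec _ go
    where
    go : ∀ W → (∀ {V} → V < W → ∀ P → L * count x w P V ≤ Λ * V + L) → ∀ P → L * count x w P W ≤ Λ * W + L
    go zero    _  P = subst (_≤ Λ * 0 + L) (sym (*-zeroʳ L)) z≤n
    go (suc W) ih P with occursAt? x P w
    ... | no _ = ≤-trans (ih ≤-refl (suc P)) (+-monoˡ-≤ L (*-monoʳ-≤ Λ (n≤1+n W)))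
    ... | yes occ-P with search (λ t → occursAt? x (suc P + t) w) W
    ...   | inj₁ none = begin
      L * (1 + count x w (suc P) W) ≡⟨ cong (λ c → L * (1 + c)) (count-absent x w (suc P) W none) ⟩
      L * 1                         ≡⟨ *-identityʳ L ⟩
      L                             ≤⟨ m≤n+m L (Λ * suc W) ⟩
      Λ * suc W + L                 ∎
      where open ≤-Reasoning
    ...   | inj₂ (t , t<W , occ-t , first) = begin
      L * (1 + count x w (suc P) W)
        ≡⟨ cong (λ c → L * (1 + c)) skip ⟩
      L * (1 + count x w (suc P + t) (W ∸ t))
        ≡⟨ *-distribˡ-+ L 1 _ ⟩
      L * 1 + L * count x w (suc P + t) (W ∸ t)
        ≤⟨ +-mono-≤ (≤-reflexive (*-identityʳ L)) (ih (s≤s (m∸n≤m W t)) (suc P + t)) ⟩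
      L + (Λ * (W ∸ t) + L)
        ≤⟨ +-monoˡ-≤ _ (sparse P t occ-P (subst (λ Q → OccursAt x Q w) (sym (+-suc P t)) occ-t)) ⟩
      Λ * suc t + (Λ * (W ∸ t) + L)
        ≡⟨ +-assoc (Λ * suc t) _ L ⟨
      Λ * suc t + Λ * (W ∸ t) + L
        ≡⟨ cong (_+ L) (*-distribˡ-+ Λ (suc t) (W ∸ t)) ⟨
      Λ * (suc t + (W ∸ t)) + L
        ≡⟨ cong (λ V → Λ * suc V + L) (m+[n∸m]≡n (<⇒≤ t<W)) ⟩
      Λ * suc W + L ∎
      where
      open ≤-Reasoning
      skip : count x w (suc P) W ≡ count x w (suc P + t) (W ∸ t)
      skip = trans (cong (count x w (suc P)) (sym (m+[n∸m]≡n (<⇒≤ t<W))))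
                   (trans (count-+ x w (suc P) t (W ∸ t)) (cong (_+ count x w (suc P + t) (W ∸ t)) (count-absent x w (suc P) t first)))

  sparse-count-short : 1 ≤ L → ∀ c P W → W ≤ c * L → count x w P W ≤ Λ * c + 1
  sparse-count-short L≥1 c P W W≤cL = *-cancelˡ-≤ L ⦃ >-nonZero L≥1 ⦄ (begin
    L * count x w P W ≤⟨ sparse-count W P ⟩
    Λ * W + L         ≤⟨ +-monoˡ-≤ L (*-monoʳ-≤ Λ W≤cL) ⟩
    Λ * (c * L) + L   ≡⟨ rearrange L Λ c ⟩
    L * (Λ * c + 1)   ∎)
    where
    open ≤-Reasoning
    rearrange : ∀ L Λ c → Λ * (c * L) + L ≡ L * (Λ * c + 1)
    rearrange = solve-∀

module _ {n} {x : InfWord n} {Lc} (lr : LinearlyRecurrentWith Lc x) where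

  window-recurs : ∀ i N M → ∃[ j ] (M ≤ j × window x j N ≡ window x i N)
  window-recurs i N M =
    let (j , M≤j , eq) = proj₁ lr (window x i N) (InL-window x i N) M in
    j , M≤j , trans (sym (trans (factor≡window x j _) (cong (window x j) (length-window x i N)))) eq

  consecutive⇒ReturnWord : ∀ {z s t} → ¬ z ≡ [] → OccursAt x s z → OccursAt x t z → s < t →
                           (∀ r → s < r → r < t → ¬ OccursAt x r z) → ReturnWord x z (window x s (t ∸ s))
  consecutive⇒ReturnWord {z} {s} {t} z≢[] occ-s occ-t s<t none =
    subst (InL x) (sym whole) (InL-window x s (D + m)) ,
    trans (cong (isPrefix z) whole) (trans (isPrefix-window x z s (D + m) (m≤n+m m D)) (dec-true (occursAt? x s z) occ-s)) ,
    trans (cong (occ z) whole) (trans (occ-window x z z≢[] s (D + m)) (trans (cong (count x z s) (m+n∸n≡m (suc D) m)) twice))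
    where
    m = length z
    D = t ∸ s
    D′ = D ∸ 1
    s+D≡t : s + D ≡ t
    s+D≡t = m+[n∸m]≡n (<⇒≤ s<t)
    1+D′≡D : suc D′ ≡ D
    1+D′≡D = m+[n∸m]≡n (m<n⇒0<n∸m s<t)
    whole : window x s D ++ z ≡ window x s (D + m)
    whole = sym (trans (window-+ x s D m) (cong (window x s D ++_) (trans (cong (λ Q → window x Q m) s+D≡t) occ-t)))
    twice : count x z s (suc D) ≡ 2
    twice = begin
      count x z s (suc D)
        ≡⟨ cong (λ V → count x z s (suc V)) 1+D′≡D ⟨
      hit x z s + count x z (suc s) (suc D′)
        ≡⟨ cong (λ V → hit x z s + count x z (suc s) V) (+-comm 1 D′) ⟩
      hit x z s + count x z (suc s) (D′ + 1)
        ≡⟨ cong (hit x z s +_) (count-+ x z (suc s) D′ 1) ⟩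
      hit x z s + (count x z (suc s) D′ + (hit x z (suc s + D′) + 0))
        ≡⟨ cong₂ (λ a b → a + (b + (hit x z (suc s + D′) + 0))) (hit-yes x z occ-s) inside ⟩
      1 + (0 + (hit x z (suc s + D′) + 0))
        ≡⟨ cong (λ h → 1 + (h + 0)) (hit-yes x z (subst (λ Q → OccursAt x Q z) (sym last) occ-t)) ⟩
      2 ∎
      where
      open ≡-Reasoning
      last : suc s + D′ ≡ t
      last = trans (sym (+-suc s D′)) (trans (cong (s +_) 1+D′≡D) s+D≡t)
      inside : count x z (suc s) D′ ≡ 0
      inside = count-absent x z (suc s) D′ λ r r<D′ → none (suc s + r) (s≤s (m≤m+n s r))
        (subst (suc s + r <_) last (+-monoʳ-< (suc s) r<D′))

  occurs-after : ∀ {z q i} → ¬ z ≡ [] → OccursAt x q z → q ≤ i → ∃[ e ] (e ≤ Lc * length z × OccursAt x (i + e) z)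
  occurs-after {z} {q} {i} z≢[] occ-q q≤i with window-recurs q (length z) (suc i)
  ... | j , i<j , same with straddle (λ r → occursAt? x r z) occ-q q≤i (trans same occ-q) i<j
  ... | s , t , s≤i , i<t , occ-s , occ-t , none =
    t ∸ i , ≤-trans (∸-monoʳ-≤ t s≤i) gap , subst (λ Q → OccursAt x Q z) (sym (m+[n∸m]≡n (<⇒≤ i<t))) occ-t
    where
    gap : t ∸ s ≤ Lc * length z
    gap = subst (_≤ Lc * length z) (length-window x s (t ∸ s))
      (proj₂ (proj₂ lr) z _ z≢[] (q , trans (factor≡window x q _) occ-q)
        (consecutive⇒ReturnWord z≢[] occ-s occ-t (≤-<-trans s≤i i<t) none))

  occurs-within : ∀ {z q} → ¬ z ≡ [] → OccursAt x q z → ∀ i → ∃[ e ] (e ≤ Lc * length z × OccursAt x (i + e) z)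
  occurs-within {z} {q} z≢[] occ-q i =
    let (j , q≤j , same) = window-recurs i N q
        (e , e≤ , occ-e) = occurs-after z≢[] occ-q q≤j
    in e , e≤ , trans (window-cong x x (i + e) (j + e) m λ r r<m →
                   trans (cong x (+-assoc i e r))
                   (trans (sym (window-lookup x x j i N same (e + r) (inside e≤ r<m))) (cong x (sym (+-assoc j e r)))))
                occ-e
    where
    m = length z
    N = m + Lc * m
    inside : ∀ {e r} → e ≤ Lc * m → r < m → e + r < N
    inside {e} {r} e≤ r<m = subst (e + r <_) (+-comm (Lc * m) m) (+-mono-≤-< e≤ r<m)

  small-period⇒Periodic : ∀ {w i p} → OccursAt x i w → HasPeriod w (suc p) → suc Lc * suc (suc p) ≤ length w →
                          Periodic x (suc p)
  small-period⇒Periodic {w} {i} {p} occ-w period small q = shift (occurs-within z≢[] (OccursAt-window x q P) i)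
    where
    P = suc (suc p)
    z≢[] : ¬ window x q P ≡ []
    z≢[] ()
    shift : ∃[ e ] (e ≤ Lc * length (window x q P) × OccursAt x (i + e) (window x q P)) → x (q + suc p) ≡ x q
    shift (e , e≤ , occ-e) =
      trans (sym (at (suc p) ≤-refl)) (trans (occurrence-shift x occ-w period e e+p<L)
        (trans (cong x (sym (+-identityʳ (i + e)))) (trans (at 0 (s≤s z≤n)) (cong x (+-identityʳ q)))))
      where
      at : ∀ r → r < P → x (i + e + r) ≡ x (q + r)
      at = window-lookup x x (i + e) q P (subst (λ M → window x (i + e) M ≡ window x q P) (length-window x q P) occ-e)
      e+p<L : e + suc p < length w
      e+p<L = begin-strict
        e + suc p              <⟨ +-monoʳ-< e ≤-refl ⟩
        e + P                  ≤⟨ +-monoˡ-≤ P (subst (λ M → e ≤ Lc * M) (length-window x q P) e≤) ⟩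
        Lc * P + P             ≡⟨ +-comm (Lc * P) P ⟩
        suc Lc * P             ≤⟨ small ⟩
        length w               ∎
        where open ≤-Reasoning

weight : ∀ {A : Set} → (A → ℕ) → List A → ℕ
weight h u = sum (map h u)

weight-++ : ∀ {A : Set} (h : A → ℕ) u v → weight h (u ++ v) ≡ weight h u + weight h v
weight-++ h u v = trans (cong sum (map-++ h u v)) (sum-++ (map h u) (map h v))

∑-mono-≤ : ∀ {S} {f g : Fin S → ℕ} → (∀ c → f c ≤ g c) → ∑ f ≤ ∑ g
∑-mono-≤ {zero}  _   = z≤n
∑-mono-≤ {suc S} f≤g = +-mono-≤ (f≤g zero) (∑-mono-≤ (λ c → f≤g (suc c)))

∑-bounded : ∀ {S} {f : Fin S → ℕ} {K} → (∀ c → f c ≤ K) → ∑ f ≤ S * K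
∑-bounded {zero}  _    = z≤n
∑-bounded {suc S} f≤K = +-mono-≤ (f≤K zero) (∑-bounded (λ c → f≤K (suc c)))

∑-*ˡ : ∀ {S} k (f : Fin S → ℕ) → ∑[ c < S ] (k * f c) ≡ k * ∑ f
∑-*ˡ {zero}  k f = sym (*-zeroʳ k)
∑-*ˡ {suc S} k f = trans (cong (k * f zero +_) (∑-*ˡ k (λ c → f (suc c)))) (sym (*-distribˡ-+ k (f zero) _))

letter : ∀ {S} → Fin S → Fin S → ℕ
letter c b = indicator (does (c ≟ b))

∑-letter : ∀ {S} (h : Fin S → ℕ) b → ∑[ c < S ] (h c * letter c b) ≡ h b
∑-letter {suc S} h zero    = trans (cong₂ _+_ (*-identityʳ (h zero))
  (trans (sum-cong-≗ (λ c → *-zeroʳ (h (suc c)))) (sum-replicate-zero S))) (+-identityʳ (h zero))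
∑-letter {suc S} h (suc b) =
  trans (cong (_+ ∑[ c < S ] (h (suc c) * letter c b)) (*-zeroʳ (h zero))) (∑-letter (λ c → h (suc c)) b)

occ-letter : ∀ {S} (c b : Fin S) u → occ (c ∷ []) (b ∷ u) ≡ letter c b + occ (c ∷ []) u
occ-letter c b u with does (c ≟ b)
... | true  = refl
... | false = refl

weight≡∑ : ∀ {S} (h : Fin S → ℕ) u → weight h u ≡ ∑[ c < S ] (h c * occ (c ∷ []) u)
weight≡∑ {S} h [] = sym (trans (sum-cong-≗ (λ c → *-zeroʳ (h c))) (sum-replicate-zero S))
weight≡∑ h (b ∷ u) = begin
  h b + weight h u
    ≡⟨ cong₂ _+_ (∑-letter h b) (sym (weight≡∑ h u)) ⟨
  ∑[ c < _ ] (h c * letter c b) + ∑[ c < _ ] (h c * occ (c ∷ []) u)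
    ≡⟨ ∑-distrib-+ (λ c → h c * letter c b) (λ c → h c * occ (c ∷ []) u) ⟨
  ∑[ c < _ ] (h c * letter c b + h c * occ (c ∷ []) u)
    ≡⟨ sum-cong-≗ (λ c → trans (sym (*-distribˡ-+ (h c) _ _)) (cong (h c *_) (sym (occ-letter c b u)))) ⟩
  ∑[ c < _ ] (h c * occ (c ∷ []) (b ∷ u)) ∎
  where open ≡-Reasoning

weight-balanced : ∀ {S B K} (h : Fin S → ℕ) → (∀ c → h c ≤ K) → ∀ u v →
                  (∀ c → occ (c ∷ []) u ≤ occ (c ∷ []) v + B) → weight h u ≤ weight h v + B * (S * K)
weight-balanced {S} {B} {K} h h≤K u v u≤v+B = begin
  weight h u
    ≡⟨ weight≡∑ h u ⟩
  ∑[ c < S ] (h c * occ (c ∷ []) u)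
    ≤⟨ ∑-mono-≤ (λ c → *-monoʳ-≤ (h c) (u≤v+B c)) ⟩
  ∑[ c < S ] (h c * (occ (c ∷ []) v + B))
    ≡⟨ sum-cong-≗ (λ c → trans (*-distribˡ-+ (h c) _ B) (cong (h c * occ (c ∷ []) v +_) (*-comm (h c) B))) ⟩
  ∑[ c < S ] (h c * occ (c ∷ []) v + B * h c)
    ≡⟨ ∑-distrib-+ (λ c → h c * occ (c ∷ []) v) (λ c → B * h c) ⟩
  ∑[ c < S ] (h c * occ (c ∷ []) v) + ∑[ c < S ] (B * h c)
    ≡⟨ cong₂ _+_ (sym (weight≡∑ h v)) (∑-*ˡ B h) ⟩
  weight h v + B * ∑ h
    ≤⟨ +-monoʳ-≤ (weight h v) (*-monoʳ-≤ B (∑-bounded h≤K)) ⟩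
  weight h v + B * (S * K) ∎
  where open ≤-Reasoning

window-weight-balanced : ∀ {S B K} {y : InfWord S} → LetterBalanced B y → (h : Fin S → ℕ) → (∀ c → h c ≤ K) →
                         ∀ j j′ m → weight h (window y j m) ≤ weight h (window y j′ m) + B * (S * K)
window-weight-balanced {y = y} bal h h≤K j j′ m = weight-balanced h h≤K (window y j m) (window y j′ m) λ c →
  ∣-∣≤-elim (bal c _ _ (InL-window y j m) (InL-window y j′ m) (trans (length-window y j m) (sym (length-window y j′ m))))

weight-window-+ : ∀ {S} (h : Fin S → ℕ) (y : InfWord S) j a b →
                  weight h (window y j (a + b)) ≡ weight h (window y j a) + weight h (window y (j + a) b)
weight-window-+ h y j a b = trans (cong (weight h) (window-+ y j a b)) (weight-++ h (window y j a) _)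

-- Block decompositions

blockConstant : ℕ → ℕ → ℕ → ℕ
blockConstant S E B = B * (S * (E + 1)) + ((B * S + 2) * E + 1) + ((E + 1) + (E + 1))

-- Block j of x starts at position weight ℓ (window y 0 j) and has length ℓ (y j).
module BlockDecomposition {n S} (x : InfWord n) (w : Word n) (y : InfWord S) (ℓ G : Fin S → ℕ) {H E B : ℕ}
  (ℓ≤H : ∀ a → ℓ a ≤ H) (ℓ≥1 : ∀ j → 1 ≤ ℓ (y (suc j)))
  (short : ∀ c P W → W ≤ c * H → count x w P W ≤ c * E + 1)
  (blocks : ∀ j → count x w (weight ℓ (window y 0 j)) (ℓ (y j)) ≡ G (y j))
  (bal : LetterBalanced B y) where

  private
    E₁ = E + 1

    pos : ℕ → ℕ
    pos j = weight ℓ (window y 0 j)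

    len : ℕ → ℕ → ℕ
    len j m = weight ℓ (window y j m)

    count≤E₁ : ∀ P W → W ≤ H → count x w P W ≤ E₁
    count≤E₁ P W W≤H =
      subst (count x w P W ≤_) (cong (_+ 1) (*-identityˡ E)) (short 1 P W (subst (W ≤_) (sym (*-identityˡ H)) W≤H))

    -- G is pinned down only on letters occurring in y; clamping it at E₁ bounds it without changing it there.
    G′ : Fin S → ℕ
    G′ a = G a ⊓ E₁

    hits : ℕ → ℕ → ℕ
    hits j m = weight G′ (window y j m)

    blocks′ : ∀ j → count x w (pos j) (ℓ (y j)) ≡ G′ (y j)
    blocks′ j = trans (sym (m≤n⇒m⊓n≡m (count≤E₁ _ _ (ℓ≤H (y j))))) (cong (_⊓ E₁) (blocks j))

    pos-+ : ∀ j m → pos (j + m) ≡ pos j + len j m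
    pos-+ j m = weight-window-+ ℓ y 0 j m

    pos-suc : ∀ j → pos (suc j) ≡ pos j + ℓ (y j)
    pos-suc j = trans (cong pos (+-comm 1 j)) (trans (pos-+ j 1) (cong (pos j +_) (+-identityʳ _)))

    count-blocks : ∀ j m → count x w (pos j) (len j m) ≡ hits j m
    count-blocks j zero    = refl
    count-blocks j (suc m) = trans (count-+ x w (pos j) (ℓ (y j)) (len (suc j) m))
      (cong₂ _+_ (blocks′ j) (trans (cong (λ P → count x w P (len (suc j) m)) (sym (pos-suc j))) (count-blocks (suc j) m)))

    pos-mono : ∀ {i j} → i ≤ j → pos i ≤ pos j
    pos-mono {i} i≤j = subst (pos i ≤_) (trans (sym (pos-+ i _)) (cong pos (m+[n∸m]≡n i≤j))) (m≤m+n _ _)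

    pos-grows : ∀ j → j ≤ pos (suc j)
    pos-grows zero    = z≤n
    pos-grows (suc j) = subst (suc j ≤_) (sym (pos-suc (suc j)))
      (subst (_≤ pos (suc j) + ℓ (y (suc j))) (+-comm j 1) (+-mono-≤ (pos-grows j) (ℓ≥1 j)))

    block-of : ∀ Q → ∃[ j ] (pos j ≤ Q × Q < pos (suc j))
    block-of Q = crossing pos z≤n (suc (suc Q)) (pos-grows (suc Q))

    record Decomposition (P W : ℕ) : Set where
      field
        first blockCount lead rest : ℕ
        lead≤ : lead ≤ E₁
        rest≤ : rest ≤ E₁
        counts : count x w P W + lead ≡ hits first blockCount + rest
        len≤ : len first blockCount ≤ W + H
        ≥len : W ≤ len first blockCount + H

    decompose : ∀ P W → Decomposition P W
    decompose P W with block-of P | block-of (P + W)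
    ... | j₁ , j₁≤P , P<j₁+1 | j₂ , j₂≤P+W , P+W<j₂+1 = record
      { first = j₁ ; blockCount = m ; lead = count x w (pos j₁) a₁ ; rest = count x w (pos j₂) a₂
      ; lead≤ = count≤E₁ (pos j₁) a₁ (<⇒≤ a₁<H) ; rest≤ = count≤E₁ (pos j₂) a₂ (<⇒≤ a₂<H)
      ; counts = counts ; len≤ = len≤ ; ≥len = ≥len }
      where
      j₁≤j₂ : j₁ ≤ j₂
      j₁≤j₂ with j₁ ≤? j₂
      ... | yes j₁≤j₂ = j₁≤j₂
      ... | no j₁≰j₂ =
        ⊥-elim (<⇒≱ P+W<j₂+1 (≤-trans (pos-mono {suc j₂} {j₁} (≰⇒> j₁≰j₂)) (≤-trans j₁≤P (m≤m+n P W))))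
      m = j₂ ∸ j₁
      a₁ = P ∸ pos j₁
      a₂ = (P + W) ∸ pos j₂
      offset< : ∀ {j Q} → pos j ≤ Q → Q < pos (suc j) → Q ∸ pos j < H
      offset< {j} {Q} j≤Q Q<j+1 =
        <-≤-trans (+-cancelˡ-< (pos j) _ _ (subst₂ _<_ (sym (m+[n∸m]≡n j≤Q)) (pos-suc j) Q<j+1)) (ℓ≤H (y j))
      a₁<H = offset< {j₁} j₁≤P P<j₁+1
      a₂<H = offset< {j₂} j₂≤P+W P+W<j₂+1
      pos-j₂ : pos j₂ ≡ pos j₁ + len j₁ m
      pos-j₂ = trans (cong pos (sym (m+[n∸m]≡n j₁≤j₂))) (pos-+ j₁ m)
      lengths : a₁ + W ≡ len j₁ m + a₂
      lengths = +-cancelˡ-≡ (pos j₁) _ _ (begin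
        pos j₁ + (a₁ + W)        ≡⟨ +-assoc (pos j₁) a₁ W ⟨
        pos j₁ + a₁ + W          ≡⟨ cong (_+ W) (m+[n∸m]≡n j₁≤P) ⟩
        P + W                    ≡⟨ m+[n∸m]≡n j₂≤P+W ⟨
        pos j₂ + a₂              ≡⟨ cong (_+ a₂) pos-j₂ ⟩
        pos j₁ + len j₁ m + a₂   ≡⟨ +-assoc (pos j₁) _ a₂ ⟩
        pos j₁ + (len j₁ m + a₂) ∎)
        where open ≡-Reasoning
      counts : count x w P W + count x w (pos j₁) a₁ ≡ hits j₁ m + count x w (pos j₂) a₂
      counts = begin
        count x w P W + count x w (pos j₁) a₁
          ≡⟨ +-comm _ (count x w (pos j₁) a₁) ⟩
        count x w (pos j₁) a₁ + count x w P W
          ≡⟨ cong (λ Q → count x w (pos j₁) a₁ + count x w Q W) (m+[n∸m]≡n j₁≤P) ⟨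
        count x w (pos j₁) a₁ + count x w (pos j₁ + a₁) W
          ≡⟨ count-+ x w (pos j₁) a₁ W ⟨
        count x w (pos j₁) (a₁ + W)
          ≡⟨ cong (count x w (pos j₁)) lengths ⟩
        count x w (pos j₁) (len j₁ m + a₂)
          ≡⟨ count-+ x w (pos j₁) (len j₁ m) a₂ ⟩
        count x w (pos j₁) (len j₁ m) + count x w (pos j₁ + len j₁ m) a₂
          ≡⟨ cong₂ _+_ (count-blocks j₁ m) (cong (λ Q → count x w Q a₂) (sym pos-j₂)) ⟩
        hits j₁ m + count x w (pos j₂) a₂ ∎
        where open ≡-Reasoning
      len≤ : len j₁ m ≤ W + H
      len≤ = ≤-trans (m≤m+n (len j₁ m) a₂)
        (≤-trans (≤-reflexive (sym lengths)) (subst (a₁ + W ≤_) (+-comm H W) (+-monoˡ-≤ W (<⇒≤ a₁<H))))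
      ≥len : W ≤ len j₁ m + H
      ≥len = ≤-trans (m≤n+m W a₁) (≤-trans (≤-reflexive lengths) (+-monoʳ-≤ (len j₁ m) (<⇒≤ a₂<H)))

    K₁ = B * (S * E₁) + ((B * S + 2) * E + 1)

    hits-compare : ∀ j m j′ m′ W → len j m ≤ W + H → W ≤ len j′ m′ + H → hits j m ≤ hits j′ m′ + K₁
    hits-compare j m j′ m′ W len≤ ≥len with m ≤? m′
    ... | yes m≤m′ = begin
      hits j m
        ≤⟨ window-weight-balanced bal G′ (λ a → m⊓n≤n (G a) E₁) j j′ m ⟩
      hits j′ m + B * (S * E₁)
        ≤⟨ +-monoˡ-≤ _ (subst (hits j′ m ≤_) (sym more) (m≤m+n _ _)) ⟩
      hits j′ m′ + B * (S * E₁)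
        ≤⟨ +-monoʳ-≤ (hits j′ m′) (m≤m+n _ _) ⟩
      hits j′ m′ + K₁ ∎
      where
      open ≤-Reasoning
      more : hits j′ m′ ≡ hits j′ m + hits (j′ + m) (m′ ∸ m)
      more = trans (cong (hits j′) (sym (m+[n∸m]≡n m≤m′))) (weight-window-+ G′ y j′ m (m′ ∸ m))
    ... | no m≰m′ = begin
      hits j m
        ≡⟨ trans (cong (hits j) (sym (m+[n∸m]≡n m′≤m))) (weight-window-+ G′ y j m′ r) ⟩
      hits j m′ + hits (j + m′) r
        ≤⟨ +-mono-≤ (window-weight-balanced bal G′ (λ a → m⊓n≤n (G a) E₁) j j′ m′) rest-hits ⟩
      hits j′ m′ + B * (S * E₁) + ((B * S + 2) * E + 1)
        ≡⟨ +-assoc (hits j′ m′) _ _ ⟩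
      hits j′ m′ + K₁ ∎
      where
      open ≤-Reasoning
      m′≤m = <⇒≤ (≰⇒> m≰m′)
      r = m ∸ m′
      rest-len : len (j + m′) r ≤ (B * S + 2) * H
      rest-len = +-cancelˡ-≤ (len j m′) _ _ (begin
        len j m′ + len (j + m′) r
          ≡⟨ trans (cong (len j) (sym (m+[n∸m]≡n m′≤m))) (weight-window-+ ℓ y j m′ r) ⟨
        len j m
          ≤⟨ len≤ ⟩
        W + H
          ≤⟨ +-monoˡ-≤ H ≥len ⟩
        len j′ m′ + H + H
          ≤⟨ +-monoˡ-≤ H (+-monoˡ-≤ H (window-weight-balanced bal ℓ ℓ≤H j′ j m′)) ⟩
        len j m′ + B * (S * H) + H + H
          ≡⟨ rearrange (len j m′) B S H ⟩
        len j m′ + (B * S + 2) * H ∎)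
        where
        rearrange : ∀ a B S H → a + B * (S * H) + H + H ≡ a + (B * S + 2) * H
        rearrange = solve-∀
      rest-hits : hits (j + m′) r ≤ (B * S + 2) * E + 1
      rest-hits = subst (_≤ (B * S + 2) * E + 1) (count-blocks (j + m′) r)
        (short (B * S + 2) (pos (j + m′)) (len (j + m′) r) rest-len)

  CountBalanced-blocks : CountBalanced (blockConstant S E B) x w
  CountBalanced-blocks P Q W = ∣-∣≤-intro _ _ _ (bound (decompose P W) (decompose Q W)) (bound (decompose Q W) (decompose P W))
    where
    bound : ∀ {P Q} → Decomposition P W → Decomposition Q W → count x w P W ≤ count x w Q W + blockConstant S E B
    bound {P} {Q} d d′ = begin
      count x w P W
        ≤⟨ m≤m+n _ D.lead ⟩
      count x w P W + D.lead
        ≡⟨ D.counts ⟩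
      hits D.first D.blockCount + D.rest
        ≤⟨ +-mono-≤ (hits-compare D.first D.blockCount D′.first D′.blockCount W D.len≤ D′.≥len) D.rest≤ ⟩
      hits D′.first D′.blockCount + K₁ + E₁
        ≤⟨ +-monoˡ-≤ E₁ (+-monoˡ-≤ K₁ (subst (hits D′.first D′.blockCount ≤_) (sym D′.counts)
                                             (m≤m+n (hits D′.first D′.blockCount) D′.rest))) ⟩
      count x w Q W + D′.lead + K₁ + E₁
        ≤⟨ +-monoˡ-≤ E₁ (+-monoˡ-≤ K₁ (+-monoʳ-≤ (count x w Q W) D′.lead≤)) ⟩
      count x w Q W + E₁ + K₁ + E₁
        ≡⟨ rearrange (count x w Q W) E₁ K₁ ⟩
      count x w Q W + (K₁ + (E₁ + E₁)) ∎
      where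
      open ≤-Reasoning
      module D = Decomposition d
      module D′ = Decomposition d′
      rearrange : ∀ a b c → a + b + c + b ≡ a + (c + (b + b))
      rearrange = solve-∀

blockConstant-mono : ∀ {S S′ E B B′} → S ≤ S′ → B ≤ B′ → blockConstant S E B ≤ blockConstant S′ E B′
blockConstant-mono {E = E} S≤S′ B≤B′ = +-monoˡ-≤ ((E + 1) + (E + 1))
  (+-mono-≤ (*-mono-≤ B≤B′ (*-monoˡ-≤ (E + 1) S≤S′))
            (+-monoˡ-≤ 1 (*-monoˡ-≤ E (+-monoˡ-≤ 2 (*-mono-≤ B≤B′ S≤S′)))))

blockConstant≥1 : ∀ S E B → 1 ≤ blockConstant S E B
blockConstant≥1 S E B =
  ≤-trans (m≤n+m 1 E) (≤-trans (m≤m+n (E + 1) (E + 1)) (m≤n+m _ (B * (S * (E + 1)) + ((B * S + 2) * E + 1))))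

concatMap-concatMap : ∀ {A B C : Set} (f : B → List C) (g : A → List B) u →
                      concatMap f (concatMap g u) ≡ concatMap (λ a → concatMap f (g a)) u
concatMap-concatMap f g u = sym (MonadProperties.associative u g f)

length-concatMap : ∀ {A B : Set} (f : A → List B) u → length (concatMap f u) ≡ weight (λ a → length (f a)) u
length-concatMap f []      = refl
length-concatMap f (a ∷ u) = trans (length-++ (f a)) (cong (length (f a) +_) (length-concatMap f u))

length-concatMap-≤ : ∀ {A B : Set} (f : A → List B) {K} → (∀ a → length (f a) ≤ K) →
                     ∀ u → length (concatMap f u) ≤ length u * K
length-concatMap-≤ f f≤K []      = z≤n
length-concatMap-≤ f f≤K (a ∷ u) = subst (_≤ _) (sym (length-++ (f a))) (+-mono-≤ (f≤K a) (length-concatMap-≤ f f≤K u))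

length-concatMap-∈ : ∀ {A B : Set} (f : A → List B) {a u} → a ∈ u → length (f a) ≤ length (concatMap f u)
length-concatMap-∈ f {u = b ∷ u} (here refl) = subst (length (f b) ≤_) (sym (length-++ (f b))) (m≤m+n _ _)
length-concatMap-∈ f {u = b ∷ u} (there a∈u) =
  subst (length (f _) ≤_) (sym (length-++ (f b))) (≤-trans (length-concatMap-∈ f a∈u) (m≤n+m _ _))

length-concatMap-∈₂ : ∀ {A B : Set} (f : A → List B) {a a′ u} → a ∈ u → a′ ∈ u → ¬ a ≡ a′ →
                      length (f a) + length (f a′) ≤ length (concatMap f u)
length-concatMap-∈₂ f {u = b ∷ u} (here refl)  (here refl)   a≢a′ = ⊥-elim (a≢a′ refl)
length-concatMap-∈₂ f {u = b ∷ u} (here refl)  (there a′∈u) _    =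
  subst (_ ≤_) (sym (length-++ (f b))) (+-monoʳ-≤ (length (f b)) (length-concatMap-∈ f a′∈u))
length-concatMap-∈₂ f {a} {u = b ∷ u} (there a∈u) (here refl) _  =
  subst (_ ≤_) (sym (length-++ (f b)))
    (subst (_≤ length (f b) + length (concatMap f u)) (+-comm (length (f b)) (length (f a)))
      (+-monoʳ-≤ (length (f b)) (length-concatMap-∈ f a∈u)))
length-concatMap-∈₂ f {u = b ∷ u} (there a∈u) (there a′∈u) a≢a′ =
  subst (_ ≤_) (sym (length-++ (f b))) (≤-trans (length-concatMap-∈₂ f a∈u a′∈u a≢a′) (m≤n+m _ _))

module _ {s : ℕ → ℕ} (τ : Subst s) where

  castAt : ∀ {i j} → i ≡ j → Fin (s i) → Fin (s j)
  castAt e = subst (λ k → Fin (s k)) e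

  private
    τ-castAt : ∀ {i j} (e : i ≡ j) b → τ j (subst (λ k → Fin (s (suc k))) e b) ≡ map (castAt e) (τ i b)
    τ-castAt refl b = sym (map-id _)

    castAt-suc : ∀ {i j} (e : i ≡ j) b → castAt (cong suc e) b ≡ subst (λ k → Fin (s (suc k))) e b
    castAt-suc refl b = refl

  comp-+ : ∀ m d D (b : Fin (s (D + d + m))) →
           comp τ m (D + d) b ≡ concatMap (comp τ m d) (comp τ (d + m) D (castAt (+-assoc D d m) b))
  comp-+ m d zero    b = sym (++-identityʳ _)
  comp-+ m d (suc D) b = begin
    concatMap (comp τ m (D + d)) (τ (D + d + m) b)
      ≡⟨ concatMap-cong (comp-+ m d D) (τ (D + d + m) b) ⟩
    concatMap (λ c → concatMap (comp τ m d) (comp τ (d + m) D (castAt e c))) (τ (D + d + m) b)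
      ≡⟨ concatMap-map _ (castAt e) (τ (D + d + m) b) ⟨
    concatMap (λ c → concatMap (comp τ m d) (comp τ (d + m) D c)) (map (castAt e) (τ (D + d + m) b))
      ≡⟨ cong (concatMap _) (τ-castAt e b) ⟨
    concatMap (λ c → concatMap (comp τ m d) (comp τ (d + m) D c)) (τ (D + (d + m)) (subst (λ k → Fin (s (suc k))) e b))
      ≡⟨ concatMap-concatMap (comp τ m d) (comp τ (d + m) D) (τ (D + (d + m)) (subst (λ k → Fin (s (suc k))) e b)) ⟨
    concatMap (comp τ m d) (concatMap (comp τ (d + m) D) (τ (D + (d + m)) (subst (λ k → Fin (s (suc k))) e b)))
      ≡⟨ cong (λ c → concatMap (comp τ m d) (concatMap (comp τ (d + m) D) (τ (D + (d + m)) c))) (castAt-suc e b) ⟨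
    concatMap (comp τ m d) (comp τ (d + m) (suc D) (castAt (+-assoc (suc D) d m) b)) ∎
    where
    open ≡-Reasoning
    e = +-assoc D d m

module _ {s : ℕ → ℕ} {τ : Subst s} {a : (n : ℕ) → Fin (s n)} (cg : Congenial τ a)
         {xs : (n : ℕ) → InfWord (s n)} (lim : ∀ n → IsLimit τ a n (xs n)) where

  private
    C : ∀ m d → Word (s m)
    C m d = comp τ m d (a (d + m))

    C-grows : ∀ m d k → ∃[ r ] C m (k + d) ≡ C m d ++ r
    C-grows m d zero    = [] , sym (++-identityʳ _)
    C-grows m d (suc k) =
      let (r , grow) = C-grows m d k
          (rest , first) = cg (k + d + m)
      in r ++ concatMap (comp τ m (k + d)) rest ,
         trans (cong (concatMap (comp τ m (k + d))) first) (trans (cong (_++ _) grow) (++-assoc (C m d) r _))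

    prefix-agrees : ∀ {m} {u v r r′ : Word (s m)} → length u ≡ length v → u ++ r ≡ v ++ r′ → u ≡ v
    prefix-agrees l e = proj₁ (++-cancel-length _ _ l e)

  limit-prefix : ∀ m d → OccursAt (xs m) 0 (C m d)
  limit-prefix m d with lim m (length (C m d))
  ... | d′ , rest , C≡ with d ≤? d′
  ...   | yes d≤d′ = let (r , grow) = C-grows m d (d′ ∸ d) in
    sym (prefix-agrees (sym (length-window (xs m) 0 _))
      (trans (sym grow) (trans (cong (C m) (m∸n+n≡m d≤d′)) (trans C≡ (cong (_++ rest) (factor≡window (xs m) 0 _))))))
  ...   | no d≰d′ = let (r , grow) = C-grows m d′ (d ∸ d′) in
    sym (prefix-agrees (sym (length-window (xs m) 0 _))
      (trans (++-identityʳ _) (trans (cong (C m) (sym (m∸n+n≡m (<⇒≤ (≰⇒> d≰d′)))))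
        (trans grow (trans (cong (_++ r) (trans C≡ (cong (_++ rest) (factor≡window (xs m) 0 _)))) (++-assoc _ rest r))))))

  limit-blocks : ∀ n i → OccursAt (xs 0) 0 (concatMap (comp τ 0 n) (window (xs (n + 0)) 0 i))
  limit-blocks n i with lim (n + 0) i
  ... | D , rest , C≡ =
    proj₁ (OccursAt-++ (xs 0) 0 _ (concatMap (comp τ 0 n) rest) (subst (OccursAt (xs 0) 0) unfold (limit-prefix 0 (D + n))))
    where
    unfold : C 0 (D + n) ≡ concatMap (comp τ 0 n) (window (xs (n + 0)) 0 i) ++ concatMap (comp τ 0 n) rest
    unfold = begin
      C 0 (D + n)
        ≡⟨ comp-+ τ 0 n D (a (D + n + 0)) ⟩
      concatMap (comp τ 0 n) (comp τ (n + 0) D (castAt τ (+-assoc D n 0) (a (D + n + 0))))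
        ≡⟨ cong (λ c → concatMap (comp τ 0 n) (comp τ (n + 0) D c)) (castAt-a (+-assoc D n 0)) ⟩
      concatMap (comp τ 0 n) (comp τ (n + 0) D (a (D + (n + 0))))
        ≡⟨ cong (concatMap (comp τ 0 n)) (trans C≡ (cong (_++ rest) (factor≡window _ 0 i))) ⟩
      concatMap (comp τ 0 n) (window (xs (n + 0)) 0 i ++ rest)
        ≡⟨ concatMap-++ (comp τ 0 n) (window (xs (n + 0)) 0 i) rest ⟩
      concatMap (comp τ 0 n) (window (xs (n + 0)) 0 i) ++ concatMap (comp τ 0 n) rest ∎
      where
      open ≡-Reasoning
      castAt-a : ∀ {i j} (e : i ≡ j) → castAt τ e (a i) ≡ a j
      castAt-a refl = refl

  consecutive-blocks : ∀ n j → let y = xs (n + 0); block = comp τ 0 n in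
    OccursAt (xs 0) (weight (λ c → length (block c)) (window y 0 j)) (block (y j) ++ block (y (suc j)))
  consecutive-blocks n j = subst (λ P → OccursAt (xs 0) P (block (y j) ++ block (y (suc j)))) (length-concatMap block (window y 0 j))
    (proj₂ (OccursAt-++ (xs 0) 0 (concatMap block (window y 0 j)) _ (subst (OccursAt (xs 0) 0) unfold (limit-blocks n (j + 2)))))
    where
    y = xs (n + 0)
    block = comp τ 0 n
    unfold : concatMap block (window y 0 (j + 2)) ≡ concatMap block (window y 0 j) ++ (block (y j) ++ block (y (suc j)))
    unfold = trans (cong (concatMap block) (window-+ y 0 j 2))
             (trans (concatMap-++ block (window y 0 j) (y j ∷ y (suc j) ∷ []))
               (cong (λ u → concatMap block (window y 0 j) ++ (block (y j) ++ u)) (++-identityʳ _)))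

-- Block lengths across levels

maxBelow : (ℕ → ℕ) → ℕ → ℕ
maxBelow f zero    = 0
maxBelow f (suc K) = f K ⊔ maxBelow f K

maxBelow-≤ : ∀ f {K m} → m < K → f m ≤ maxBelow f K
maxBelow-≤ f {suc K} (s≤s m≤K) with m≤n⇒m<n∨m≡n m≤K
... | inj₁ m<K  = ≤-trans (maxBelow-≤ f m<K) (m≤n⊔m (f K) _)
... | inj₂ refl = m≤m⊔n _ _

maxFin : ∀ {S} → (Fin S → ℕ) → ℕ
maxFin {zero}  f = 0
maxFin {suc S} f = f zero ⊔ maxFin (λ c → f (suc c))

maxFin-≤ : ∀ {S} (f : Fin S → ℕ) c → f c ≤ maxFin f
maxFin-≤ f zero    = m≤m⊔n _ _
maxFin-≤ f (suc c) = ≤-trans (maxFin-≤ (λ c → f (suc c)) c) (m≤n⊔m _ _)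

Fin1-unique : ∀ {m} → m ≡ 1 → (u v : Fin m) → u ≡ v
Fin1-unique refl zero zero = refl

two-distinct : ∀ {m} → Fin m → ¬ m ≡ 1 → Σ (Fin m) λ b → Σ (Fin m) λ b′ → ¬ b ≡ b′
two-distinct {suc zero}    _ m≢1 = ⊥-elim (m≢1 refl)
two-distinct {suc (suc m)} _ _   = zero , suc zero , λ ()

module Levels {s : ℕ → ℕ} (τ : Subst s) (k : ℕ) (positive : ∀ n → Positive τ n k)
              (N : ℕ) (finite : ∀ n → ∃[ m ] (m < N × SameSubst τ m n)) where

  S : ℕ
  S = maxBelow s N

  s≤S : ∀ n → s n ≤ S
  s≤S n with finite n
  ... | m , m<N , s-eq , _ = subst (_≤ S) s-eq (maxBelow-≤ s m<N)

  M : ℕ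
  M = suc (maxBelow (λ m → maxFin (λ b → length (τ m b))) N)

  length-τ≤M : ∀ n b → length (τ n b) ≤ M
  length-τ≤M n b with finite n
  ... | m , m<N , _ , s-eq , same = begin
    length (τ n b)                   ≡⟨ cong (λ c → length (τ n c)) (cast-involutive s-eq (sym s-eq) b) ⟨
    length (τ n (cast s-eq b′))      ≡⟨ cong length (same b′) ⟨
    length (map _ (τ m b′))          ≡⟨ length-map _ (τ m b′) ⟩
    length (τ m b′)                  ≤⟨ maxFin-≤ (λ b → length (τ m b)) b′ ⟩
    maxFin (λ b → length (τ m b))    ≤⟨ maxBelow-≤ (λ m → maxFin (λ b → length (τ m b))) m<N ⟩
    maxBelow (λ m → maxFin (λ b → length (τ m b))) N ≤⟨ n≤1+n _ ⟩
    M                                ∎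
    where
    open ≤-Reasoning
    b′ = cast (sym s-eq) b

  length-comp≤ : ∀ m d c → length (comp τ m d c) ≤ M ^ d
  length-comp≤ m zero    c = s≤s z≤n
  length-comp≤ m (suc d) c =
    ≤-trans (length-concatMap-≤ (comp τ m d) (length-comp≤ m d) (τ (d + m) c)) (*-monoˡ-≤ (M ^ d) (length-τ≤M (d + m) c))

  -- comp τ m d maps letters of the alphabet at level d + m, hence the ubiquitous `+ 0`.
  ℓ : (d : ℕ) → Fin (s (d + 0)) → ℕ
  ℓ d c = length (comp τ 0 d c)

  private
    k-step : ∀ i c → comp τ 0 (k + i) c ≡ concatMap (comp τ 0 i) (comp τ (i + 0) k (castAt τ (+-assoc k i 0) c))
    k-step i c = comp-+ τ 0 i k c

  ℓ≤ℓ-next : ∀ i b c → ℓ i b ≤ ℓ (k + i) c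
  ℓ≤ℓ-next i b c =
    subst (λ u → ℓ i b ≤ length u) (sym (k-step i c)) (length-concatMap-∈ (comp τ 0 i) (positive (i + 0) b _))

  ℓ+ℓ≤ℓ-next : ∀ i b b′ c → ¬ b ≡ b′ → ℓ i b + ℓ i b′ ≤ ℓ (k + i) c
  ℓ+ℓ≤ℓ-next i b b′ c b≢b′ = subst (λ u → ℓ i b + ℓ i b′ ≤ length u) (sym (k-step i c))
    (length-concatMap-∈₂ (comp τ 0 i) (positive (i + 0) b _) (positive (i + 0) b′ _) b≢b′)

  ℓ-next≤ : ∀ i {X} → (∀ b → ℓ i b ≤ X) → ∀ c → ℓ (k + i) c ≤ M ^ k * X
  ℓ-next≤ i {X} ℓ≤X c = subst (λ u → length u ≤ M ^ k * X) (sym (k-step i c))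
    (≤-trans (length-concatMap-≤ (comp τ 0 i) ℓ≤X (comp τ (i + 0) k c′)) (*-monoˡ-≤ X (length-comp≤ (i + 0) k c′)))
    where c′ = castAt τ (+-assoc k i 0) c

  ℓ-suc≤ : ∀ i {X} → (∀ b → ℓ i b ≤ X) → ∀ c → ℓ (suc i) c ≤ M * X
  ℓ-suc≤ i {X} ℓ≤X c =
    ≤-trans (length-concatMap-≤ (comp τ 0 i) ℓ≤X (τ (i + 0) c)) (*-monoˡ-≤ X (length-τ≤M (i + 0) c))

  M^k≥1 : 1 ≤ M ^ k
  M^k≥1 = m^n>0 M k

  ℓ-ratio : ∀ j b c → ℓ (j * k) b ≤ M ^ k * ℓ (j * k) c
  ℓ-ratio zero    b c = ≤-trans (≤-reflexive (sym (*-identityʳ 1))) (*-monoˡ-≤ 1 M^k≥1)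
  ℓ-ratio (suc j) b c = ℓ-next≤ (j * k) (λ b′ → ℓ≤ℓ-next (j * k) b′ c) b

  λ′ : ℕ
  λ′ = M * (M ^ k * M ^ k)

  data LevelChoice (L : ℕ) : Set where
    long-blocks : ∀ j → (∀ c → L ≤ ℓ (j * k) c) → (∀ c → ℓ (suc (j * k)) c ≤ λ′ * L) → LevelChoice L
    unary-level : ∀ j → s (j * k + 0) ≡ 1 → ∀ c → 1 ≤ ℓ (j * k) c → ℓ (j * k) c < L → LevelChoice L

  -- Climb j = 0, 1, … keeping every level-jk block longer than j and at most (M ^ k)² L long;
  -- a level with two letters lets the next one grow by one, so at most L steps are needed.
  choose-level : ∀ {L} → 1 ≤ L → LevelChoice L
  choose-level {L} L≥1 = ascend L 0 (n≤1+n L) (λ _ → s≤s z≤n) (λ _ → *-mono-≤ M^k≥1 (*-mono-≤ M^k≥1 L≥1))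
    where
    Long Bounded : ℕ → Set
    Long j = ∀ c → suc j ≤ ℓ (j * k) c
    Bounded j = ∀ c → ℓ (j * k) c ≤ M ^ k * (M ^ k * L)

    rearrange : ∀ M m L → M * (m * (m * L)) ≡ M * (m * m) * L
    rearrange = solve-∀

    ascend : ∀ fuel j → L ≤ suc j + fuel → Long j → Bounded j → LevelChoice L
    ascend fuel j L≤ long bounded with all? (λ c → L ≤? ℓ (j * k) c)
    ... | yes all-long = long-blocks j all-long λ c → ≤-trans (ℓ-suc≤ (j * k) bounded c) (≤-reflexive (rearrange M (M ^ k) L))
    ... | no ¬all-long with ¬∀⟶∃¬ _ _ (λ c → L ≤? ℓ (j * k) c) ¬all-long
    ...   | c , ℓc≱L with s (j * k + 0) ≟ℕ 1
    ...     | yes unary = unary-level j unary c (≤-trans (s≤s z≤n) (long c)) (≰⇒> ℓc≱L)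
    ...     | no ¬unary with two-distinct c ¬unary
    ...       | b , b′ , b≢b′ = climb fuel L≤
      where
      long′ : Long (suc j)
      long′ c′ = ≤-trans (s≤s (m≤n+m (suc j) j))
        (≤-trans (+-mono-≤ (long b) (long b′)) (ℓ+ℓ≤ℓ-next (j * k) b b′ c′ b≢b′))
      bounded′ : Bounded (suc j)
      bounded′ = ℓ-next≤ (j * k) λ b → ≤-trans (ℓ-ratio j b c) (*-monoʳ-≤ (M ^ k) (<⇒≤ (≰⇒> ℓc≱L)))
      climb : ∀ fuel → L ≤ suc j + fuel → LevelChoice L
      climb zero        L≤ = ⊥-elim (ℓc≱L (≤-trans (subst (L ≤_) (+-identityʳ (suc j)) L≤) (long c)))
      climb (suc fuel) L≤ = ascend fuel (suc j) (subst (L ≤_) (+-suc (suc j) fuel) L≤) long′ bounded′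

Decisive⇒first-letter : ∀ {p q} {σ : Fin p → Word q} {y : InfWord p} → Decisive σ y →
  Σ (Fin p → Fin q) λ first → ∀ a b → InL y (a ∷ b ∷ []) → ∃[ rest ] σ b ≡ first a ∷ rest
Decisive⇒first-letter (suc _ , _ , r , decides) = (λ a → head (r a)) , λ a b ab → starts (r a) (decides a b ab)
  where
  starts : ∀ {q k} {u : Word q} (v : Vec (Fin q) (suc k)) → ∃[ rest ] u ≡ toList v ++ rest → ∃[ rest ] u ≡ head v ∷ rest
  starts (c ∷ v) (rest , u≡) = toList v ++ rest , u≡

module FactorBalance {s : ℕ → ℕ} {τ : Subst s} {a : (n : ℕ) → Fin (s n)} (cg : Congenial τ a)
  {xs : (n : ℕ) → InfWord (s n)} (lim : ∀ n → IsLimit τ a n (xs n))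
  {Lc : ℕ} (lr : LinearlyRecurrentWith Lc (xs 0))
  {k : ℕ} (positive : ∀ n → Positive τ n k) {N : ℕ} (finite : ∀ n → ∃[ m ] (m < N × SameSubst τ m n))
  (decisive : CondD τ xs) (B : ℕ → ℕ) (balanced : ∀ n → LetterBalanced (B n) (xs n)) where

  open Levels τ k positive N finite public using (S; λ′)
  open Levels τ k positive N finite using (s≤S; ℓ; long-blocks; unary-level; choose-level)

  private
    x = xs 0
    Λ = suc Lc + suc Lc

  E : ℕ
  E = Λ * λ′

  Balance : Word (s 0) → Set
  Balance w = ∃[ n ] CountBalanced (blockConstant S E (B n)) x w

  private
    1-balanced⇒Balance : ∀ {w} → CountBalanced 1 x w → Balance w
    1-balanced⇒Balance bal = 0 , CountBalanced-mono (blockConstant≥1 S E (B 0)) bal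

    block-start : ∀ n → ℕ → ℕ
    block-start n j = weight (ℓ n) (window (xs (n + 0)) 0 j)

    block-occurs : ∀ n j → OccursAt x (block-start n j) (comp τ 0 n (xs (n + 0) j))
    block-occurs n j = proj₁ (OccursAt-++ x _ _ _ (consecutive-blocks cg lim n j))

  unary-balance : ∀ {w} j → s (j * k + 0) ≡ 1 → ∀ c → 1 ≤ ℓ (j * k) c → ℓ (j * k) c < length w → Balance w
  unary-balance {w} j unary c ℓ≥1 ℓ<w =
    1-balanced⇒Balance (periodic-CountBalanced x w (subst (_≤ length w) p≡ (<⇒≤ ℓ<w)) (subst (Periodic x) p≡ periodic))
    where
    y = xs (j * k + 0)
    p = ℓ (j * k) c
    p≡ : p ≡ suc (p ∸ 1)
    p≡ = sym (m+[n∸m]≡n ℓ≥1)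
    only-c : ∀ i → y i ≡ c
    only-c i = Fin1-unique unary (y i) c
    starts : ∀ P i → weight (ℓ (j * k)) (window y P i) ≡ i * p
    starts P zero    = refl
    starts P (suc i) = cong₂ _+_ (cong (ℓ (j * k)) (only-c P)) (starts (suc P) i)
    periodic : Periodic x p
    periodic = tiled-Periodic ⦃ >-nonZero ℓ≥1 ⦄ λ i →
      subst₂ (λ P b → OccursAt x P (comp τ 0 (j * k) b)) (starts 0 i) (only-c i) (block-occurs (j * k) i)

  private
    module Lookahead (j : ℕ) where
      n : ℕ
      n = suc (j * k)

      y : InfWord (s (n + 0))
      y = xs (n + 0)

      block : Fin (s (n + 0)) → Word (s 0)
      block = comp τ 0 n

      first-letter : Σ (Fin (s (n + 0)) → Fin (s (j * k + 0))) λ first →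
                     ∀ a b → InL y (a ∷ b ∷ []) → ∃[ rest ] τ (j * k + 0) b ≡ first a ∷ rest
      first-letter = Decisive⇒first-letter {σ = τ (j * k + 0)} {y = y} (decisive (j * k + 0))

      lookahead : Fin (s (n + 0)) → Word (s 0)
      lookahead b = comp τ 0 (j * k) (proj₁ first-letter b)

      next-block : ∀ i → ∃[ rest ] block (y (suc i)) ≡ lookahead (y i) ++ rest
      next-block i with proj₂ first-letter (y i) (y (suc i)) (i , factor≡window y i 2)
      ... | rest , starts = concatMap (comp τ 0 (j * k)) rest , cong (concatMap (comp τ 0 (j * k))) starts

      lookahead≤next : ∀ i → length (lookahead (y i)) ≤ ℓ n (y (suc i))
      lookahead≤next i = subst (λ u → length (lookahead (y i)) ≤ length u) (sym (proj₂ (next-block i)))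
        (subst (length (lookahead (y i)) ≤_) (sym (length-++ (lookahead (y i)))) (m≤m+n _ _))

      extended-block : ∀ i → OccursAt x (block-start n i) (block (y i) ++ lookahead (y i))
      extended-block i = proj₁ (OccursAt-++ x _ (block (y i) ++ lookahead (y i)) (proj₁ (next-block i))
        (subst (OccursAt x (block-start n i)) (trans (cong (block (y i) ++_) (proj₂ (next-block i))) (sym (++-assoc (block (y i)) _ _)))
          (consecutive-blocks cg lim n i)))

  long-balance : ∀ {w} → Sparse Λ x w → 1 ≤ length w → ∀ j →
                 (∀ c → length w ≤ ℓ (j * k) c) → (∀ c → ℓ (suc (j * k)) c ≤ λ′ * length w) → Balance w
  long-balance {w} sparse w≥1 j long bounded =
    n + 0 , CountBalanced-mono (blockConstant-mono {E = E} {B = B (n + 0)} (s≤S (n + 0)) ≤-refl)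
      (BlockDecomposition.CountBalanced-blocks x w y (ℓ n) G bounded nonempty short counts (balanced (n + 0)))
    where
    open Lookahead j
    L = length w
    nonempty : ∀ i → 1 ≤ ℓ n (y (suc i))
    nonempty i = ≤-trans w≥1 (≤-trans (long _) (lookahead≤next i))
    G : Fin (s (n + 0)) → ℕ
    G b = occurrencesIn w (block b ++ lookahead b) (ℓ n b)
    counts : ∀ i → count x w (block-start n i) (ℓ n (y i)) ≡ G (y i)
    counts i = count-occurring x w (ℓ n (y i)) (extended-block i)
      (subst (ℓ n (y i) + L ≤_) (sym (length-++ (block (y i)))) (+-monoʳ-≤ (ℓ n (y i)) (long _)))
    short : ∀ c P W → W ≤ c * (λ′ * L) → count x w P W ≤ c * E + 1
    short c P W W≤ = subst (λ C → count x w P W ≤ C + 1) (rearrange Λ c λ′)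
      (sparse-count-short {Λ = Λ} sparse w≥1 (c * λ′) P W (subst (W ≤_) (sym (*-assoc c λ′ L)) W≤))
      where
      rearrange : ∀ Λ c l → Λ * (c * l) ≡ c * (Λ * l)
      rearrange = solve-∀

  sparse-balance : ∀ {w} → Sparse Λ x w → 1 ≤ length w → Balance w
  sparse-balance sparse w≥1 with choose-level w≥1
  ... | long-blocks j long bounded   = long-balance sparse w≥1 j long bounded
  ... | unary-level j unary c ℓ≥1 ℓ<w = unary-balance j unary c ℓ≥1 ℓ<w

  SmallPeriod : Word (s 0) → ℕ → Set
  SmallPeriod w p = HasPeriod w (suc p) × suc Lc * suc (suc p) ≤ length w

  smallPeriod? : ∀ w p → Dec (SmallPeriod w p)
  smallPeriod? w p = (isPrefix (drop (suc p) w) w Bool.≟ true) ×-dec (suc Lc * suc (suc p) ≤? length w)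

  no-small-period⇒Sparse : ∀ {w} → (∀ p → p < length w → ¬ SmallPeriod w p) → Sparse Λ x w
  no-small-period⇒Sparse {w} none i d occ occ′ with length w ≤? suc d
  ... | yes w≤d+1 = ≤-trans w≤d+1 (m≤n*m (suc d) Λ)
  ... | no w≰d+1  = ≤-trans (<⇒≤ (≰⇒> not-small)) (bound Lc d)
    where
    not-small : ¬ suc Lc * suc (suc d) ≤ length w
    not-small small = none d (≤-trans (n≤1+n _) (≰⇒> w≰d+1)) (overlapping⇒HasPeriod x occ occ′ , small)
    bound : ∀ Lc d → suc Lc * suc (suc d) ≤ (suc Lc + suc Lc) * suc d
    bound Lc d = begin
      suc Lc * suc (suc d)              ≡⟨ *-suc (suc Lc) (suc d) ⟩
      suc Lc + suc Lc * suc d           ≤⟨ +-monoˡ-≤ _ (m≤m*n (suc Lc) (suc d)) ⟩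
      suc Lc * suc d + suc Lc * suc d   ≡⟨ *-distribʳ-+ (suc d) (suc Lc) (suc Lc) ⟨
      (suc Lc + suc Lc) * suc d         ∎
      where open ≤-Reasoning

  balance : ∀ w → Balance w
  balance []        = 0 , CountBalanced-[] x _
  balance w@(_ ∷ _) with search (smallPeriod? w) (length w)
  ... | inj₁ none = sparse-balance (no-small-period⇒Sparse none) (s≤s z≤n)
  ... | inj₂ (p , _ , (period , small) , _) = 1-balanced⇒Balance (CountBalanced-if-occurring x w λ occ →
    periodic-CountBalanced x w (≤-trans (n≤1+n _) (≤-trans (m≤n*m (suc (suc p)) (suc Lc)) small))
      (small-period⇒Periodic {Lc = Lc} lr occ period small))

theorem1p2 : (s : ℕ → ℕ) (τ : Subst s) (a : (n : ℕ) → Fin (s n)) →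
    Congenial τ a →
    (xs : (n : ℕ) → InfWord (s n)) → (∀ n → IsLimit τ a n (xs n)) →
    LinearlyRecurrent (xs 0) →
    CondP τ → CondF τ → CondD τ xs →
    (B : ℕ → ℕ) → (∀ n → 0 < B n) → (∀ n → LetterBalanced (B n) (xs n)) →
    FactorBalanced (xs 0) × (BoundedSeq B → UniformlyFactorBalanced (xs 0))
theorem1p2 s τ a cg xs lim (L , lr) (_ , positive) (_ , finite) decisive B _ balanced = factor-balanced , uniformly
  where
  open FactorBalance cg lim {Lc = L} lr positive finite decisive B balanced
  factor-balanced : FactorBalanced (xs 0)
  factor-balanced w =
    let (n , bal) = balance w in blockConstant S E (B n) , blockConstant≥1 S E (B n) , CountBalanced⇒Balanced w bal
  uniformly : BoundedSeq B → UniformlyFactorBalanced (xs 0)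
  uniformly (B* , B≤B*) = blockConstant S E B* , blockConstant≥1 S E B* , λ w →
    let (n , bal) = balance w in CountBalanced⇒Balanced w (CountBalanced-mono (blockConstant-mono {E = E} ≤-refl (B≤B* n)) bal)
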